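{- Let $a\in\mathbb N$. There exist polynomials $P_{a,\ell,n}(x)$ (for $\ell\in\mathbb N_0$, $n\in\mathbb N$) and $P_{a,\ell,m,n}(x)$ (for $\ell\in\mathbb N_0$, $m,n\in\mathbb N$), each of degree at most $\ell$, such that for all $k\in\mathbb Z$ and $r,s\in\mathbb N$, $$\mathcal A_{a,k,r}(q)=\sum_{\ell\ge0}\ \sum_{n\ge\frac{a(a+1)}2}P_{a,\ell,n}(k)\,q^{nr+\ell},\qquad \mathcal B_{a,k,r,s}(q)=\sum_{\ell\ge0}\ \sum_{n\ge\frac{a(a+1)}2}\ \sum_{\frac{n^2}{a}\le m\le n^2}P_{a,\ell,m,n}(k)\,q^{mr+ns+\ell}.$$
   Context: For $a,r,s\in\mathbb N$ and $k\in\mathbb Z$ define $$\mathcal A_{a,k,r}(q):=\sum_{1\le n_1<\dots<n_a}\frac{q^{r(n_1+\dots+n_a)}}{(1-q^{n_1})^k\cdots(1-q^{n_a})^k},\qquad \mathcal B_{a,k,r,s}(q):=\sum_{1\le n_1<\dots<n_a}\frac{q^{r(n_1^2+\dots+n_a^2)+s(n_1+\dots+n_a)}}{(1-q^{n_1})^k\cdots(1-q^{n_a})^k},$$ viewed as formal power series in $q$. The polynomials $P_{a,\ell,n}$, $P_{a,\ell,m,n}$ do not depend on $k,r,s$. -}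

module Defs where

open import Data.Nat as ℕ using (ℕ; zero; suc; _∸_)
open import Data.Integer as ℤ using (ℤ; +_; -[1+_])
open import Data.Rational as ℚ using (ℚ; 0ℚ)
open import Data.List using (List; []; _∷_; _++_; [_]; map; foldr; upTo; concatMap)
open import Data.Bool using (Bool; true; false; if_then_else_; _∧_)
open import Relation.Nullary.Decidable using (⌊_⌋)

-- Formal power series in q with integer coefficients, given by their
-- coefficient sequence:  f ↔ Σ_N f(N) q^N.

Series : Set
Series = ℕ → ℤ

sumℤ : List ℤ → ℤ
sumℤ = foldr ℤ._+_ (+ 0)

sumℚ : List ℚ → ℚ
sumℚ = foldr ℚ._+_ 0ℚ

ind : Bool → ℤ
ind b = if b then + 1 else + 0

oneS : Series
oneS zero    = + 1
oneS (suc _) = + 0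

monoS : ℕ → Series
monoS m N = ind ⌊ N ℕ.≟ m ⌋

_⊖_ : Series → Series → Series
(f ⊖ g) N = f N ℤ.- g N

_⊛_ : Series → Series → Series
(f ⊛ g) N = sumℤ (map (λ i → f i ℤ.* g (N ∸ i)) (upTo (suc N)))

infixl 7 _⊛_

powS : Series → ℕ → Series
powS f zero    = oneS
powS f (suc m) = f ⊛ powS f m

prodS : List Series → Series
prodS = foldr _⊛_ oneS

-- (1 - q^n)^{-1} = Σ_{j≥0} q^{n j}   (used only for n ≥ 1);
-- coefficient of q^N is Σ_{j=0}^{N} [n j = N].
geomS : ℕ → Series
geomS n N = sumℤ (map (λ j → ind ⌊ n ℕ.* j ℕ.≟ N ⌋) (upTo (suc N)))

-- (1 - q^n)^{-k} for k ∈ ℤ: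
--   k = m ≥ 0   : ((1 - q^n)^{-1})^m
--   k = -(m+1)  : (1 - q^n)^{m+1}
invPowS : ℕ → ℤ → Series
invPowS n (+ m)      = powS (geomS n) m
invPowS n -[1+ m ]   = powS (oneS ⊖ monoS n) (suc m)

-- Strictly increasing a-tuples 1 ≤ n₁ < … < n_a ≤ N, as increasing lists.
incTuples : ℕ → ℕ → List (List ℕ)
incTuples zero    N       = [] ∷ []
incTuples (suc a) zero    = []
incTuples (suc a) (suc N) =
  incTuples (suc a) N ++ map (λ t → t ++ [ suc N ]) (incTuples a N)

termA : ℤ → ℕ → List ℕ → Series
termA k r t = prodS (map (λ n → monoS (r ℕ.* n) ⊛ invPowS n k) t)

termB : ℤ → ℕ → ℕ → List ℕ → Series
termB k r s t =
  prodS (map (λ n → monoS (r ℕ.* (n ℕ.* n) ℕ.+ s ℕ.* n) ⊛ invPowS n k) t)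

-- Since r ≥ 1, a summand with
-- n_a > N has q-order ≥ r(n₁+…+n_a) > N, so only tuples with n_a ≤ N
-- contribute to the coefficient of q^N (the family is summable).
coeffA : ℕ → ℤ → ℕ → Series
coeffA a k r N = sumℤ (map (λ t → termA k r t N) (incTuples a N))

coeffB : ℕ → ℤ → ℕ → ℕ → Series
coeffB a k r s N = sumℤ (map (λ t → termB k r s t N) (incTuples a N))

-- Polynomials over ℚ as coefficient lists [c₀, c₁, …] ↔ Σ cᵢ xⁱ.
-- "degree ≤ ℓ" is expressed as  length ≤ ℓ + 1.
Poly : Set
Poly = List ℚ

toℚ : ℤ → ℚ
toℚ z = z ℚ./ 1

evalP : Poly → ℚ → ℚ
evalP p x = foldr (λ c acc → c ℚ.+ x ℚ.* acc) 0ℚ p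

-- All contributing indices satisfy ℓ, n ≤ N (as r ≥ 1), so the sum
-- ranges over ℓ, n ∈ {0,…,N} with the indicated conditions.
rhsA : ℕ → (ℕ → ℕ → Poly) → ℤ → ℕ → ℕ → ℚ
rhsA a P k r N =
  sumℚ (concatMap (λ ℓ → map (λ n →
    if ⌊ a ℕ.* suc a ℕ.≤? 2 ℕ.* n ⌋ ∧ ⌊ n ℕ.* r ℕ.+ ℓ ℕ.≟ N ⌋
    then evalP (P ℓ n) (toℚ k) else 0ℚ)
    (upTo (suc N))) (upTo (suc N)))

-- Coefficient of q^N in
--   Σ_{ℓ≥0} Σ_{n ≥ a(a+1)/2} Σ_{n²/a ≤ m ≤ n²} P_{ℓ,m,n}(k) q^{m r + n s + ℓ}.
-- (n²/a ≤ m is written n·n ≤ a·m.)  All contributing ℓ, m, n are ≤ N.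
rhsB : ℕ → (ℕ → ℕ → ℕ → Poly) → ℤ → ℕ → ℕ → ℕ → ℚ
rhsB a P k r s N =
  sumℚ (concatMap (λ ℓ → concatMap (λ n → map (λ m →
    if ⌊ a ℕ.* suc a ℕ.≤? 2 ℕ.* n ⌋
       ∧ ⌊ n ℕ.* n ℕ.≤? a ℕ.* m ⌋ ∧ ⌊ m ℕ.≤? n ℕ.* n ⌋
       ∧ ⌊ m ℕ.* r ℕ.+ n ℕ.* s ℕ.+ ℓ ℕ.≟ N ⌋
    then evalP (P ℓ m n) (toℚ k) else 0ℚ)
    (upTo (suc N))) (upTo (suc N))) (upTo (suc N)))

module Submission where

-- For a tuple n₁ < ⋯ < n_a, the summand of 𝒜_{a,k,r} is q^{r Σ nᵢ} Π (1 - q^{nᵢ})^{-k}, and that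
-- of ℬ_{a,k,r,s} is q^{r Σ nᵢ² + s Σ nᵢ} Π (1 - q^{nᵢ})^{-k}.  The coefficient of q^{n j} in
-- (1 - q^n)^{-k} is the polynomial (k + j - 1 choose j) of degree j: both sides, as series f_k,
-- satisfy f_{k+1} = f_k + q^n f_{k+1} (on the right by Pascal's rule), and this recurrence
-- determines f_{k+1} from f_k and f_k from f_{k+1}, so agreement at k = 0 spreads to all k ∈ ℤ.
-- Hence the coefficient of q^ℓ in the product is a polynomial in k of degree ≤ ℓ, and P_{a,ℓ,n}
-- (resp. P_{a,ℓ,m,n}) is its sum over the tuples with Σ nᵢ = n (and Σ nᵢ² = m).  The ranges of
-- n and m come from Σ nᵢ ≥ a(a+1)/2, from Cauchy–Schwarz (Σ nᵢ)² ≤ a Σ nᵢ², and from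
-- Σ nᵢ² ≤ (Σ nᵢ)².

open import Defs
open import Algebra.Bundles using (CommutativeSemigroup)
import Algebra.Properties.CommutativeSemigroup as CommutativeSemigroupProperties
open import Algebra.Structures using (IsCommutativeMonoid)
open import Data.Bool using (Bool; true; false; if_then_else_; _∧_)
import Data.Bool.Properties as Bool
open import Data.Integer as ℤ using (ℤ; +_; -[1+_])
import Data.Integer.Properties as ℤ
open import Data.Integer.Tactic.RingSolver using (solve-∀)
open import Data.List using (List; []; _∷_; _++_; [_]; map; foldr; upTo; applyUpTo; concatMap; length)
import Data.List.Properties as List
open import Data.List.Relation.Unary.All as All using (All; []; _∷_)
import Data.List.Relation.Unary.All.Properties as All
open import Data.Nat as ℕ using (ℕ; zero; suc; _<_; _≤_; z≤n; s≤s)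
open import Data.Nat.Induction using (<-rec)
open import Data.Nat.ListAction using (sum)
open import Data.Nat.ListAction.Properties using (sum-++)
import Data.Nat.Properties as ℕ
import Data.Nat.Tactic.RingSolver as ℕ-Solver
open import Data.Product using (Σ; _×_; _,_)
open import Data.Rational as ℚ using (ℚ; 0ℚ; 1ℚ)
import Data.Rational.Properties as ℚ
open import Data.Rational.Solver using (module +-*-Solver)
import Data.Rational.Unnormalised as ℚᵘ
import Data.Rational.Unnormalised.Properties as ℚᵘ
open import Algebra.Properties.Group ℚ.+-0-group using () renaming (∙-cancelʳ to +-cancelʳ)
open import Data.Sum using (_⊎_; inj₁; inj₂)
open import Function using (_∘_; _⇔_; mk⇔; Equivalence)
open import Level using (0ℓ)
open import Relation.Binary.PropositionalEquality hiding ([_])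
open import Relation.Nullary using (Dec; yes; no; ¬_)
open import Relation.Nullary.Decidable using (⌊_⌋)
open import Relation.Nullary.Negation using (contradiction)

⌊⌋-yes : ∀ {P : Set} (d : Dec P) → P → ⌊ d ⌋ ≡ true
⌊⌋-yes (yes _) _ = refl
⌊⌋-yes (no ¬p) p = contradiction p ¬p

⌊⌋-no : ∀ {P : Set} (d : Dec P) → ¬ P → ⌊ d ⌋ ≡ false
⌊⌋-no (yes p) ¬p = contradiction p ¬p
⌊⌋-no (no _) _ = refl

⌊⌋-⇔ : ∀ {P Q : Set} → P ⇔ Q → (p : Dec P) (q : Dec Q) → ⌊ p ⌋ ≡ ⌊ q ⌋
⌊⌋-⇔ P⇔Q (yes p) q = sym (⌊⌋-yes q (Equivalence.to P⇔Q p))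
⌊⌋-⇔ P⇔Q (no ¬p) q = sym (⌊⌋-no q (¬p ∘ Equivalence.from P⇔Q))

-- Finite sums

module Sum {A : Set} (_+_ : A → A → A) (0# : A) where

  ∑ : List A → A
  ∑ = foldr _+_ 0#

  ∑[<_] : ℕ → (ℕ → A) → A
  ∑[< n ] f = ∑ (applyUpTo f n)

  -- The coefficient of q^N in h(q^n), where h(q) = Σ_j h j q^j.
  dilate : ℕ → (ℕ → A) → ℕ → A
  dilate n h N = ∑ (map (λ j → if ⌊ n ℕ.* j ℕ.≟ N ⌋ then h j else 0#) (upTo (suc N)))

module SumHomomorphism {A B : Set} {_+_ : A → A → A} {0# : A} {_⊕_ : B → B → B} {0b : B}
  (φ : A → B) (φ-+ : ∀ x y → φ (x + y) ≡ φ x ⊕ φ y) (φ-0 : φ 0# ≡ 0b) where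

  open Sum

  ∑-map-homo : ∀ {C : Set} (f : C → A) xs → φ (∑ _+_ 0# (map f xs)) ≡ ∑ _⊕_ 0b (map (φ ∘ f) xs)
  ∑-map-homo f [] = φ-0
  ∑-map-homo f (x ∷ xs) = trans (φ-+ _ _) (cong (φ (f x) ⊕_) (∑-map-homo f xs))

  if-homo : ∀ b x → φ (if b then x else 0#) ≡ (if b then φ x else 0b)
  if-homo true x = refl
  if-homo false x = φ-0

  dilate-homo : ∀ n h N → φ (dilate _+_ 0# n h N) ≡ dilate _⊕_ 0b n (φ ∘ h) N
  dilate-homo n h N = trans (∑-map-homo _ (upTo (suc N)))
    (cong (∑ _⊕_ 0b) (List.map-cong (λ j → if-homo ⌊ n ℕ.* j ℕ.≟ N ⌋ (h j)) (upTo (suc N))))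

module SumProperties {A : Set} {_+_ : A → A → A} {0# : A}
  (isCM : IsCommutativeMonoid _≡_ _+_ 0#) where

  open Sum _+_ 0# public
  open IsCommutativeMonoid isCM using (assoc; identityˡ; identityʳ; isCommutativeSemigroup)

  +-commutativeSemigroup : CommutativeSemigroup 0ℓ 0ℓ
  +-commutativeSemigroup = record { isCommutativeSemigroup = isCommutativeSemigroup }

  open CommutativeSemigroupProperties +-commutativeSemigroup using (interchange)
  open ≡-Reasoning

  if-0# : ∀ b → (if b then 0# else 0#) ≡ 0#
  if-0# true = refl
  if-0# false = refl

  if-≢ : ∀ {m n} x → m ≢ n → (if ⌊ m ℕ.≟ n ⌋ then x else 0#) ≡ 0#
  if-≢ {m} {n} x m≢n = cong (if_then x else 0#) (⌊⌋-no (m ℕ.≟ n) m≢n)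

  if-≡ : ∀ {m n} x → m ≡ n → (if ⌊ m ℕ.≟ n ⌋ then x else 0#) ≡ x
  if-≡ {m} {n} x m≡n = cong (if_then x else 0#) (⌊⌋-yes (m ℕ.≟ n) m≡n)

  if-swap : ∀ b d x → (if d then (if b then x else 0#) else 0#) ≡ (if b then (if d then x else 0#) else 0#)
  if-swap true  d     x = refl
  if-swap false true  x = refl
  if-swap false false x = refl

  if-∧-swap : ∀ b c d x →
    (if d then (if b ∧ c then x else 0#) else 0#) ≡ (if c then (if b then (if d then x else 0#) else 0#) else 0#)
  if-∧-swap true  true  d x = refl
  if-∧-swap true  false true  x = refl
  if-∧-swap true  false false x = refl
  if-∧-swap false true  true  x = refl
  if-∧-swap false true  false x = refl
  if-∧-swap false false true  x = refl
  if-∧-swap false false false x = refl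

  if-+ : ∀ b x y → (if b then x + y else 0#) ≡ (if b then x else 0#) + (if b then y else 0#)
  if-+ true x y = refl
  if-+ false x y = sym (identityˡ 0#)

  ∑-++ : ∀ xs ys → ∑ (xs ++ ys) ≡ ∑ xs + ∑ ys
  ∑-++ [] ys = sym (identityˡ _)
  ∑-++ (x ∷ xs) ys = trans (cong (_+_ x) (∑-++ xs ys)) (sym (assoc x _ _))

  ∑-map-cong : ∀ {B : Set} {f g : B → A} xs → (∀ x → f x ≡ g x) → ∑ (map f xs) ≡ ∑ (map g xs)
  ∑-map-cong xs f≗g = cong ∑ (List.map-cong f≗g xs)

  ∑-map-congᴬ : ∀ {B : Set} {f g : B → A} {xs} → All (λ x → f x ≡ g x) xs → ∑ (map f xs) ≡ ∑ (map g xs)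
  ∑-map-congᴬ [] = refl
  ∑-map-congᴬ (p ∷ ps) = cong₂ _+_ p (∑-map-congᴬ ps)

  ∑-map-zero : ∀ {B : Set} {f : B → A} xs → (∀ x → f x ≡ 0#) → ∑ (map f xs) ≡ 0#
  ∑-map-zero [] _ = refl
  ∑-map-zero (x ∷ xs) f≗0 = trans (cong₂ _+_ (f≗0 x) (∑-map-zero xs f≗0)) (identityˡ 0#)

  ∑-map-+ : ∀ {B : Set} (f g : B → A) xs → ∑ (map (λ x → f x + g x) xs) ≡ ∑ (map f xs) + ∑ (map g xs)
  ∑-map-+ f g [] = sym (identityˡ 0#)
  ∑-map-+ f g (x ∷ xs) = trans (cong (_+_ (f x + g x)) (∑-map-+ f g xs)) (interchange _ _ _ _)

  ∑-map-swap : ∀ {B C : Set} (f : B → C → A) xs ys →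
    ∑ (map (λ x → ∑ (map (f x) ys)) xs) ≡ ∑ (map (λ y → ∑ (map (λ x → f x y) xs)) ys)
  ∑-map-swap f [] ys = sym (∑-map-zero ys (λ _ → refl))
  ∑-map-swap f (x ∷ xs) ys = trans (cong (_+_ (∑ (map (f x) ys))) (∑-map-swap f xs ys))
    (sym (∑-map-+ (f x) (λ y → ∑ (map (λ x′ → f x′ y) xs)) ys))

  ∑-concatMap : ∀ {B : Set} (g : B → List A) xs → ∑ (concatMap g xs) ≡ ∑ (map (∑ ∘ g) xs)
  ∑-concatMap g [] = refl
  ∑-concatMap g (x ∷ xs) = trans (∑-++ (g x) (concatMap g xs)) (cong (_+_ (∑ (g x))) (∑-concatMap g xs))

  ∑-map-if : ∀ {B : Set} b (f : B → A) xs →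
    (if b then ∑ (map f xs) else 0#) ≡ ∑ (map (λ x → if b then f x else 0#) xs)
  ∑-map-if true f xs = refl
  ∑-map-if false f xs = sym (∑-map-zero xs (λ _ → refl))

  ∑-upTo : ∀ (f : ℕ → A) n → ∑ (map f (upTo n)) ≡ ∑[< n ] f
  ∑-upTo f n = cong ∑ (List.map-upTo f n)

  ∑[<]-+ : ∀ (f : ℕ → A) m n → ∑[< m ℕ.+ n ] f ≡ ∑[< m ] f + ∑[< n ] (λ i → f (m ℕ.+ i))
  ∑[<]-+ f zero n = sym (identityˡ _)
  ∑[<]-+ f (suc m) n = trans (cong (_+_ (f 0)) (∑[<]-+ (f ∘ suc) m n)) (sym (assoc (f 0) _ _))

  ∑[<]-cong : ∀ n {f g : ℕ → A} → (∀ i → i < n → f i ≡ g i) → ∑[< n ] f ≡ ∑[< n ] g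
  ∑[<]-cong zero f≗g = refl
  ∑[<]-cong (suc n) f≗g = cong₂ _+_ (f≗g 0 (s≤s z≤n)) (∑[<]-cong n (λ i i<n → f≗g (suc i) (s≤s i<n)))

  ∑[<]-zero : ∀ n {f : ℕ → A} → (∀ i → i < n → f i ≡ 0#) → ∑[< n ] f ≡ 0#
  ∑[<]-zero zero f≗0 = refl
  ∑[<]-zero (suc n) f≗0 =
    trans (cong₂ _+_ (f≗0 0 (s≤s z≤n)) (∑[<]-zero n (λ i i<n → f≗0 (suc i) (s≤s i<n)))) (identityˡ 0#)

  ∑[<]-single : ∀ n m (f : ℕ → A) → m < n → (∀ i → i ≢ m → f i ≡ 0#) → ∑[< n ] f ≡ f m
  ∑[<]-single n m f m<n f≗0 = begin
    ∑[< n ] f                                         ≡⟨ cong (λ k → ∑[< k ] f) (sym n≡m+1+d) ⟩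
    ∑[< m ℕ.+ suc d ] f                               ≡⟨ ∑[<]-+ f m (suc d) ⟩
    ∑[< m ] f + (f (m ℕ.+ 0) + ∑[< d ] (λ i → f (m ℕ.+ suc i)))
      ≡⟨ cong₂ _+_ (∑[<]-zero m (λ i i<m → f≗0 i (ℕ.<⇒≢ i<m)))
                   (cong₂ _+_ (cong f (ℕ.+-identityʳ m)) (∑[<]-zero d (λ i _ → f≗0 _ (ℕ.m+1+n≢m m)))) ⟩
    0# + (f m + 0#)                                   ≡⟨ trans (identityˡ _) (identityʳ _) ⟩
    f m                                               ∎
    where
      d = n ℕ.∸ suc m
      n≡m+1+d : m ℕ.+ suc d ≡ n
      n≡m+1+d = trans (ℕ.+-suc m d) (ℕ.m+[n∸m]≡n m<n)

  ∑-upTo-single : ∀ n m (f : ℕ → A) → m < n → (∀ i → i ≢ m → f i ≡ 0#) → ∑ (map f (upTo n)) ≡ f m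
  ∑-upTo-single n m f m<n f≗0 = trans (∑-upTo f n) (∑[<]-single n m f m<n f≗0)

  ∑-upTo-zero : ∀ n {f : ℕ → A} → (∀ i → i < n → f i ≡ 0#) → ∑ (map f (upTo n)) ≡ 0#
  ∑-upTo-zero n {f} f≗0 = trans (∑-upTo f n) (∑[<]-zero n f≗0)

  ∑-upTo-cong : ∀ n {f g : ℕ → A} → (∀ i → i < n → f i ≡ g i) → ∑ (map f (upTo n)) ≡ ∑ (map g (upTo n))
  ∑-upTo-cong n {f} {g} f≗g = trans (∑-upTo f n) (trans (∑[<]-cong n f≗g) (sym (∑-upTo g n)))

  ∑-upTo-collapse : ∀ N n₀ (F : ℕ → A) → (N < n₀ → F n₀ ≡ 0#) →
    ∑ (map (λ n → if ⌊ n₀ ℕ.≟ n ⌋ then F n else 0#) (upTo (suc N))) ≡ F n₀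
  ∑-upTo-collapse N n₀ F F≡0 with n₀ ℕ.≤? N
  ... | yes n₀≤N = trans (∑-upTo-single (suc N) n₀ _ (s≤s n₀≤N) (λ n n≢n₀ → if-≢ (F n) (n≢n₀ ∘ sym)))
                         (if-≡ (F n₀) refl)
  ... | no n₀≰N = trans (∑-upTo-zero (suc N) (λ n n≤N → if-≢ (F n) (λ { refl → n₀≰N (ℕ.≤-pred n≤N) })))
                        (sym (F≡0 (ℕ.≰⇒> n₀≰N)))

  ∑[<]-extend : ∀ m d (f : ℕ → A) → (∀ i → i < d → f (m ℕ.+ i) ≡ 0#) → ∑[< m ℕ.+ d ] f ≡ ∑[< m ] f
  ∑[<]-extend m d f tail≗0 =
    trans (∑[<]-+ f m d) (trans (cong (_+_ (∑[< m ] f)) (∑[<]-zero d tail≗0)) (identityʳ _))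

  module _ (n : ℕ) .{{_ : ℕ.NonZero n}} where

    dilate-cong : ∀ {h h′ : ℕ → A} N → (∀ j → h j ≡ h′ j) → dilate n h N ≡ dilate n h′ N
    dilate-cong N h≗h′ = ∑-map-cong (upTo (suc N)) (λ j → cong (if ⌊ n ℕ.* j ℕ.≟ N ⌋ then_else 0#) (h≗h′ j))

    dilate-+ : ∀ (h h′ : ℕ → A) N → dilate n (λ j → h j + h′ j) N ≡ dilate n h N + dilate n h′ N
    dilate-+ h h′ N = trans (∑-map-cong (upTo (suc N)) (λ j → if-+ ⌊ n ℕ.* j ℕ.≟ N ⌋ (h j) (h′ j)))
      (∑-map-+ (λ j → if ⌊ n ℕ.* j ℕ.≟ N ⌋ then h j else 0#) (λ j → if ⌊ n ℕ.* j ℕ.≟ N ⌋ then h′ j else 0#)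
               (upTo (suc N)))

    dilate-zero : ∀ h → dilate n h 0 ≡ h 0
    dilate-zero h = trans (cong (_+ 0#) (if-≡ (h 0) (ℕ.*-zeroʳ n))) (identityʳ _)

    dilate-< : ∀ h N → 0 < N → N < n → dilate n h N ≡ 0#
    dilate-< h N 0<N N<n = ∑-map-zero (upTo (suc N)) λ where
      zero    → if-≢ (h 0) (λ n*0≡N → ℕ.<⇒≢ 0<N (trans (sym (ℕ.*-zeroʳ n)) n*0≡N))
      (suc j) → if-≢ (h (suc j)) (λ n*j≡N → ℕ.<⇒≢ (ℕ.<-≤-trans N<n (ℕ.m≤m*n n (suc j))) (sym n*j≡N))

    dilate-vanish : ∀ h N → h 0 ≡ 0# → N < n → dilate n h N ≡ 0#
    dilate-vanish h zero h0≡0 _ = trans (dilate-zero h) h0≡0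
    dilate-vanish h (suc N) _ N<n = dilate-< h (suc N) (s≤s z≤n) N<n

    dilate-supported-at-0 : ∀ h N → (∀ j → h (suc j) ≡ 0#) → dilate n h (suc N) ≡ 0#
    dilate-supported-at-0 h N h≗0 = ∑-map-zero (upTo (suc (suc N))) λ where
      zero    → if-≢ (h 0) (λ n*0≡1+N → ℕ.0≢1+n (trans (sym (ℕ.*-zeroʳ n)) n*0≡1+N))
      (suc j) → trans (cong (if ⌊ n ℕ.* suc j ℕ.≟ suc N ⌋ then_else 0#) (h≗0 j)) (if-0# _)

    dilate-upTo : ∀ h N B → N < B → dilate n h N ≡ ∑[< B ] (λ j → if ⌊ n ℕ.* j ℕ.≟ N ⌋ then h j else 0#)
    dilate-upTo h N B N<B = begin
      dilate n h N                     ≡⟨ ∑-upTo T (suc N) ⟩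
      ∑[< suc N ] T                    ≡⟨ sym (∑[<]-extend (suc N) (B ℕ.∸ suc N) T tail≗0) ⟩
      ∑[< suc N ℕ.+ (B ℕ.∸ suc N) ] T  ≡⟨ cong (λ k → ∑[< k ] T) (ℕ.m+[n∸m]≡n N<B) ⟩
      ∑[< B ] T                        ∎
      where
        T = λ j → if ⌊ n ℕ.* j ℕ.≟ N ⌋ then h j else 0#
        tail≗0 : ∀ i → i < B ℕ.∸ suc N → T (suc N ℕ.+ i) ≡ 0#
        tail≗0 i _ = if-≢ (h _) (λ e → ℕ.<⇒≢ (ℕ.<-≤-trans (ℕ.m≤m+n (suc N) i) (ℕ.m≤n*m _ n)) (sym e))

    dilate-shift : ∀ h M → dilate n h (n ℕ.+ M) ≡ dilate n (h ∘ suc) M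
    dilate-shift h M = begin
      dilate n h (n ℕ.+ M)
        ≡⟨ ∑-upTo _ (suc (n ℕ.+ M)) ⟩
      (if ⌊ n ℕ.* 0 ℕ.≟ n ℕ.+ M ⌋ then h 0 else 0#)
        + ∑[< n ℕ.+ M ] (λ j → if ⌊ n ℕ.* suc j ℕ.≟ n ℕ.+ M ⌋ then h (suc j) else 0#)
        ≡⟨ cong₂ _+_ (if-≢ (h 0) n*0≢n+M)
                     (∑[<]-cong (n ℕ.+ M) (λ j _ → cong (if_then h (suc j) else 0#) (⌊⌋-⇔ (n*j≡M⇔ j) _ _))) ⟩
      0# + ∑[< n ℕ.+ M ] (λ j → if ⌊ n ℕ.* j ℕ.≟ M ⌋ then h (suc j) else 0#)
        ≡⟨ identityˡ _ ⟩
      ∑[< n ℕ.+ M ] (λ j → if ⌊ n ℕ.* j ℕ.≟ M ⌋ then h (suc j) else 0#)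
        ≡⟨ sym (dilate-upTo (h ∘ suc) M (n ℕ.+ M) (ℕ.m<n+m M (ℕ.>-nonZero⁻¹ n))) ⟩
      dilate n (h ∘ suc) M ∎
      where
        n*0≢n+M : n ℕ.* 0 ≢ n ℕ.+ M
        n*0≢n+M e = ℕ.<⇒≢ (ℕ.<-≤-trans (ℕ.>-nonZero⁻¹ n) (ℕ.m≤m+n n M)) (trans (sym (ℕ.*-zeroʳ n)) e)
        n*j≡M⇔ : ∀ j → (n ℕ.* suc j ≡ n ℕ.+ M) ⇔ (n ℕ.* j ≡ M)
        n*j≡M⇔ j = mk⇔ (λ e → ℕ.+-cancelˡ-≡ n _ _ (trans (sym (ℕ.*-suc n j)) e))
                       (λ e → trans (ℕ.*-suc n j) (cong (n ℕ.+_) e))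

module ℤ∑ = SumProperties ℤ.+-0-isCommutativeMonoid
module ℚ∑ = SumProperties ℚ.+-0-isCommutativeMonoid

infix 5 ∑≤ ∑∈

∑≤ : ℕ → (ℕ → ℚ) → ℚ
∑≤ N f = ℚ∑.∑ (map f (upTo (suc N)))

syntax ∑≤ N (λ i → e) = ∑[ i ≤ N ] e

∑∈ : ∀ {B : Set} → List B → (B → ℚ) → ℚ
∑∈ xs f = ℚ∑.∑ (map f xs)

syntax ∑∈ xs (λ x → e) = ∑[ x ∈ xs ] e

-- Formal power series

<-or-+ : ∀ a N → N < a ⊎ Σ ℕ (λ M → N ≡ a ℕ.+ M)
<-or-+ zero N = inj₂ (N , refl)
<-or-+ (suc a) zero = inj₁ (s≤s z≤n)
<-or-+ (suc a) (suc N) with <-or-+ a N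
... | inj₁ N<a = inj₁ (s≤s N<a)
... | inj₂ (M , refl) = inj₂ (M , refl)

infixl 6 _⊕_

_⊕_ : Series → Series → Series
(f ⊕ g) N = f N ℤ.+ g N

shift : ℕ → Series → Series
shift zero f N = f N
shift (suc a) f zero = + 0
shift (suc a) f (suc N) = shift a f N

shift-+ : ∀ a f M → shift a f (a ℕ.+ M) ≡ f M
shift-+ zero f M = refl
shift-+ (suc a) f M = shift-+ a f M

shift-< : ∀ a f N → N < a → shift a f N ≡ + 0
shift-< (suc a) f zero _ = refl
shift-< (suc a) f (suc N) (s≤s N<a) = shift-< a f N N<a

shift-cong : ∀ a {f g : Series} → (∀ M → f M ≡ g M) → ∀ N → shift a f N ≡ shift a g N
shift-cong zero f≗g N = f≗g N
shift-cong (suc a) f≗g zero = refl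
shift-cong (suc a) f≗g (suc N) = shift-cong a f≗g N

shift-shift : ∀ a b f N → shift a (shift b f) N ≡ shift (a ℕ.+ b) f N
shift-shift zero b f N = refl
shift-shift (suc a) b f zero = refl
shift-shift (suc a) b f (suc N) = shift-shift a b f N

monoS≗shift-oneS : ∀ a N → monoS a N ≡ shift a oneS N
monoS≗shift-oneS zero zero = refl
monoS≗shift-oneS zero (suc N) = refl
monoS≗shift-oneS (suc a) zero = refl
monoS≗shift-oneS (suc a) (suc N) =
  trans (cong ind (⌊⌋-⇔ (mk⇔ ℕ.suc-injective (cong suc)) (suc N ℕ.≟ suc a) (N ℕ.≟ a))) (monoS≗shift-oneS a N)

⊛-def : ∀ f g N → (f ⊛ g) N ≡ ℤ∑.∑[< suc N ] (λ i → f i ℤ.* g (N ℕ.∸ i))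
⊛-def f g N = ℤ∑.∑-upTo (λ i → f i ℤ.* g (N ℕ.∸ i)) (suc N)

oneS-pos : ∀ {N} → 0 < N → oneS N ≡ + 0
oneS-pos {suc N} _ = refl

⊛-cong : ∀ {f f′ g g′ : Series} → (∀ i → f i ≡ f′ i) → (∀ i → g i ≡ g′ i) →
         ∀ N → (f ⊛ g) N ≡ (f′ ⊛ g′) N
⊛-cong f≗f′ g≗g′ N = ℤ∑.∑-map-cong (upTo (suc N)) (λ i → cong₂ ℤ._*_ (f≗f′ i) (g≗g′ (N ℕ.∸ i)))

⊛-identityˡ : ∀ f N → (oneS ⊛ f) N ≡ f N
⊛-identityˡ f N =
  trans (ℤ∑.∑-upTo-single (suc N) 0 _ (s≤s z≤n) off-0) (ℤ.*-identityˡ (f N))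
  where
    off-0 : ∀ i → i ≢ 0 → oneS i ℤ.* f (N ℕ.∸ i) ≡ + 0
    off-0 zero i≢0 = contradiction refl i≢0
    off-0 (suc i) _ = refl

shift-⊛ : ∀ a (f g : Series) N → (shift a f ⊛ g) N ≡ shift a (f ⊛ g) N
shift-⊛ a f g N with <-or-+ a N
... | inj₁ N<a = begin
  (shift a f ⊛ g) N ≡⟨ ⊛-def (shift a f) g N ⟩
  ℤ∑.∑[< suc N ] (λ i → shift a f i ℤ.* g (N ℕ.∸ i))
    ≡⟨ ℤ∑.∑[<]-zero (suc N) (λ i i≤N → cong (ℤ._* g (N ℕ.∸ i)) (shift-< a f i (ℕ.<-≤-trans i≤N N<a))) ⟩
  + 0 ≡⟨ sym (shift-< a (f ⊛ g) N N<a) ⟩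
  shift a (f ⊛ g) N ∎
  where open ≡-Reasoning
... | inj₂ (M , refl) = begin
  (shift a f ⊛ g) (a ℕ.+ M)  ≡⟨ ⊛-def (shift a f) g (a ℕ.+ M) ⟩
  ℤ∑.∑[< suc (a ℕ.+ M) ] F   ≡⟨ cong (λ k → ℤ∑.∑[< k ] F) (sym (ℕ.+-suc a M)) ⟩
  ℤ∑.∑[< a ℕ.+ suc M ] F     ≡⟨ ℤ∑.∑[<]-+ F a (suc M) ⟩
  ℤ∑.∑[< a ] F ℤ.+ ℤ∑.∑[< suc M ] (λ i → F (a ℕ.+ i))
    ≡⟨ cong₂ ℤ._+_ (ℤ∑.∑[<]-zero a (λ i i<a → cong (ℤ._* _) (shift-< a f i i<a)))
                   (ℤ∑.∑[<]-cong (suc M) (λ i _ →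
                      cong₂ ℤ._*_ (shift-+ a f i) (cong g (ℕ.[m+n]∸[m+o]≡n∸o a M i)))) ⟩
  + 0 ℤ.+ ℤ∑.∑[< suc M ] (λ i → f i ℤ.* g (M ℕ.∸ i)) ≡⟨ ℤ.+-identityˡ _ ⟩
  ℤ∑.∑[< suc M ] (λ i → f i ℤ.* g (M ℕ.∸ i))          ≡⟨ sym (⊛-def f g M) ⟩
  (f ⊛ g) M                                          ≡⟨ sym (shift-+ a (f ⊛ g) M) ⟩
  shift a (f ⊛ g) (a ℕ.+ M)                          ∎
  where
    open ≡-Reasoning
    F = λ i → shift a f i ℤ.* g (a ℕ.+ M ℕ.∸ i)

⊛-shift : ∀ b (f g : Series) N → (f ⊛ shift b g) N ≡ shift b (f ⊛ g) N
⊛-shift b f g N with <-or-+ b N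
... | inj₁ N<b = begin
  (f ⊛ shift b g) N ≡⟨ ⊛-def f (shift b g) N ⟩
  ℤ∑.∑[< suc N ] (λ i → f i ℤ.* shift b g (N ℕ.∸ i))
    ≡⟨ ℤ∑.∑[<]-zero (suc N) (λ i _ → trans (cong (f i ℤ.*_) (shift-< b g _ (ℕ.≤-<-trans (ℕ.m∸n≤m N i) N<b)))
                                           (ℤ.*-zeroʳ (f i))) ⟩
  + 0 ≡⟨ sym (shift-< b (f ⊛ g) N N<b) ⟩
  shift b (f ⊛ g) N ∎
  where open ≡-Reasoning
... | inj₂ (M , refl) = begin
  (f ⊛ shift b g) (b ℕ.+ M)   ≡⟨ ⊛-def f (shift b g) (b ℕ.+ M) ⟩
  ℤ∑.∑[< suc (b ℕ.+ M) ] F    ≡⟨ cong (λ k → ℤ∑.∑[< suc k ] F) (ℕ.+-comm b M) ⟩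
  ℤ∑.∑[< suc M ℕ.+ b ] F      ≡⟨ ℤ∑.∑[<]-extend (suc M) b F tail≗0 ⟩
  ℤ∑.∑[< suc M ] F
    ≡⟨ ℤ∑.∑[<]-cong (suc M) (λ i i≤M → cong (f i ℤ.*_)
         (trans (cong (shift b g) (ℕ.+-∸-assoc b (ℕ.≤-pred i≤M))) (shift-+ b g (M ℕ.∸ i)))) ⟩
  ℤ∑.∑[< suc M ] (λ i → f i ℤ.* g (M ℕ.∸ i)) ≡⟨ sym (⊛-def f g M) ⟩
  (f ⊛ g) M                                  ≡⟨ sym (shift-+ b (f ⊛ g) M) ⟩
  shift b (f ⊛ g) (b ℕ.+ M)                  ∎
  where
    open ≡-Reasoning
    F = λ i → f i ℤ.* shift b g (b ℕ.+ M ℕ.∸ i)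
    tail≗0 : ∀ i → i < b → F (suc M ℕ.+ i) ≡ + 0
    tail≗0 i i<b = trans (cong (f _ ℤ.*_) (shift-< b g _ b+M∸[1+M+i]<b)) (ℤ.*-zeroʳ (f _))
      where
        1+M+i≤b+M : suc M ℕ.+ i ≤ b ℕ.+ M
        1+M+i≤b+M = ℕ.≤-trans (ℕ.≤-reflexive (sym (ℕ.+-suc M i)))
                      (ℕ.≤-trans (ℕ.+-monoʳ-≤ M i<b) (ℕ.≤-reflexive (ℕ.+-comm M b)))
        b+M∸[1+M+i]<b : b ℕ.+ M ℕ.∸ (suc M ℕ.+ i) < b
        b+M∸[1+M+i]<b = subst (b ℕ.+ M ℕ.∸ (suc M ℕ.+ i) <_) (ℕ.m+n∸n≡m b M)
                          (ℕ.∸-monoʳ-< (s≤s (ℕ.m≤m+n M i)) 1+M+i≤b+M)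

monoS-⊛ : ∀ a f N → (monoS a ⊛ f) N ≡ shift a f N
monoS-⊛ a f N = trans (⊛-cong {g = f} (monoS≗shift-oneS a) (λ _ → refl) N)
                      (trans (shift-⊛ a oneS f N) (shift-cong a (⊛-identityˡ f) N))

prodS-monoS : ∀ (w : ℕ → ℕ) (I : ℕ → Series) t N →
  prodS (map (λ n → monoS (w n) ⊛ I n) t) N ≡ shift (sum (map w t)) (prodS (map I t)) N
prodS-monoS w I [] N = refl
prodS-monoS w I (n ∷ t) N = begin
  ((monoS (w n) ⊛ I n) ⊛ prodS (map (λ n → monoS (w n) ⊛ I n) t)) N
    ≡⟨ ⊛-cong (monoS-⊛ (w n) (I n)) (prodS-monoS w I t) N ⟩
  (shift (w n) (I n) ⊛ shift (sum (map w t)) T) N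
    ≡⟨ shift-⊛ (w n) (I n) _ N ⟩
  shift (w n) (I n ⊛ shift (sum (map w t)) T) N
    ≡⟨ shift-cong (w n) (⊛-shift (sum (map w t)) (I n) T) N ⟩
  shift (w n) (shift (sum (map w t)) (I n ⊛ T)) N
    ≡⟨ shift-shift (w n) (sum (map w t)) (I n ⊛ T) N ⟩
  shift (sum (map w (n ∷ t))) (prodS (map I (n ∷ t))) N ∎
  where
    open ≡-Reasoning
    T = prodS (map I t)

⊛-distribʳ-⊕ : ∀ f g h N → ((f ⊕ g) ⊛ h) N ≡ (f ⊛ h) N ℤ.+ (g ⊛ h) N
⊛-distribʳ-⊕ f g h N =
  trans (ℤ∑.∑-map-cong (upTo (suc N)) (λ i → ℤ.*-distribʳ-+ (h (N ℕ.∸ i)) (f i) (g i)))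
        (ℤ∑.∑-map-+ (λ i → f i ℤ.* h (N ℕ.∸ i)) (λ i → g i ℤ.* h (N ℕ.∸ i)) (upTo (suc N)))

module Negation = SumHomomorphism {_+_ = ℤ._+_} {+ 0} {ℤ._+_} {+ 0} ℤ.-_ ℤ.neg-distrib-+ refl

⊛-distribʳ-⊖ : ∀ f g h N → ((f ⊖ g) ⊛ h) N ≡ (f ⊛ h) N ℤ.- (g ⊛ h) N
⊛-distribʳ-⊖ f g h N = trans (⊛-distribʳ-⊕ f (ℤ.-_ ∘ g) h N) (cong (ℤ._+_ ((f ⊛ h) N)) neg-⊛)
  where
    neg-⊛ : ((ℤ.-_ ∘ g) ⊛ h) N ≡ ℤ.- (g ⊛ h) N
    neg-⊛ = trans (ℤ∑.∑-map-cong (upTo (suc N)) (λ i → sym (ℤ.neg-distribˡ-* (g i) (h (N ℕ.∸ i)))))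
                  (sym (Negation.∑-map-homo (λ i → g i ℤ.* h (N ℕ.∸ i)) (upTo (suc N))))

module _ (n : ℕ) .{{_ : ℕ.NonZero n}} where

  geomS-rec : ∀ N → geomS n N ≡ (oneS ⊕ shift n (geomS n)) N
  geomS-rec N with <-or-+ n N
  ... | inj₁ N<n = trans (below N N<n) (sym (cong (ℤ._+_ (oneS N)) (shift-< n (geomS n) N N<n)))
    where
      below : ∀ N → N < n → geomS n N ≡ oneS N ℤ.+ + 0
      below zero    _   = ℤ∑.dilate-zero n (λ _ → + 1)
      below (suc N) N<n = ℤ∑.dilate-< n (λ _ → + 1) (suc N) (s≤s z≤n) N<n
  ... | inj₂ (M , refl) =
    trans (ℤ∑.dilate-shift n (λ _ → + 1) M)
          (sym (trans (cong₂ ℤ._+_ oneS[n+M]≡0 (shift-+ n (geomS n) M)) (ℤ.+-identityˡ _)))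
    where
      oneS[n+M]≡0 : oneS (n ℕ.+ M) ≡ + 0
      oneS[n+M]≡0 = oneS-pos (ℕ.<-≤-trans (ℕ.>-nonZero⁻¹ n) (ℕ.m≤m+n n M))

  invPowS-+-rec : ∀ m N → invPowS n (+ suc m) N ≡ (invPowS n (+ m) ⊕ shift n (invPowS n (+ suc m))) N
  invPowS-+-rec m N = begin
    (geomS n ⊛ F) N                                  ≡⟨ ⊛-cong {g = F} geomS-rec (λ _ → refl) N ⟩
    ((oneS ⊕ shift n (geomS n)) ⊛ F) N               ≡⟨ ⊛-distribʳ-⊕ oneS (shift n (geomS n)) F N ⟩
    (oneS ⊛ F) N ℤ.+ (shift n (geomS n) ⊛ F) N       ≡⟨ cong₂ ℤ._+_ (⊛-identityˡ F N) (shift-⊛ n (geomS n) F N) ⟩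
    F N ℤ.+ shift n (geomS n ⊛ F) N                  ∎
    where
      open ≡-Reasoning
      F = invPowS n (+ m)

  powS-[1-q^n]-rec : ∀ m N →
    powS (oneS ⊖ monoS n) m N ≡ (powS (oneS ⊖ monoS n) (suc m) ⊕ shift n (powS (oneS ⊖ monoS n) m)) N
  powS-[1-q^n]-rec m N = begin
    P N                                                      ≡⟨ x≡x-y+y (P N) (shift n P N) ⟩
    P N ℤ.- shift n P N ℤ.+ shift n P N                      ≡⟨ cong (ℤ._+ shift n P N) (sym 1-q^n⊛P) ⟩
    ((oneS ⊖ monoS n) ⊛ P) N ℤ.+ shift n P N                 ∎
    where
      open ≡-Reasoning
      P = powS (oneS ⊖ monoS n) m
      x≡x-y+y : ∀ x y → x ≡ x ℤ.- y ℤ.+ y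
      x≡x-y+y = solve-∀
      1-q^n⊛P : ((oneS ⊖ monoS n) ⊛ P) N ≡ P N ℤ.- shift n P N
      1-q^n⊛P = trans (⊛-distribʳ-⊖ oneS (monoS n) P N) (cong₂ ℤ._-_ (⊛-identityˡ P N) (monoS-⊛ n P N))

  invPowS-suc-rec : ∀ k N → invPowS n (ℤ.suc k) N ≡ (invPowS n k ⊕ shift n (invPowS n (ℤ.suc k))) N
  invPowS-suc-rec (+ m)          = invPowS-+-rec m
  invPowS-suc-rec -[1+ zero ]    = powS-[1-q^n]-rec zero
  invPowS-suc-rec -[1+ suc m ]   = powS-[1-q^n]-rec (suc m)

toℚᵘ-toℚ : ∀ i → ℚ.toℚᵘ (toℚ i) ℚᵘ.≃ ℚᵘ.mkℚᵘ i 0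
toℚᵘ-toℚ i = ℚ.toℚᵘ-fromℚᵘ (ℚᵘ.mkℚᵘ i 0)

toℚ-homo-+ : ∀ i j → toℚ (i ℤ.+ j) ≡ toℚ i ℚ.+ toℚ j
toℚ-homo-+ i j = ℚ.toℚᵘ-injective (begin
  ℚ.toℚᵘ (toℚ (i ℤ.+ j))                     ≈⟨ toℚᵘ-toℚ (i ℤ.+ j) ⟩
  ℚᵘ.mkℚᵘ (i ℤ.+ j) 0                        ≈⟨ ℚᵘ.*≡* (lemma i j) ⟩
  ℚᵘ.mkℚᵘ i 0 ℚᵘ.+ ℚᵘ.mkℚᵘ j 0
    ≈⟨ ℚᵘ.+-cong (ℚᵘ.≃-sym (toℚᵘ-toℚ i)) (ℚᵘ.≃-sym (toℚᵘ-toℚ j)) ⟩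
  ℚ.toℚᵘ (toℚ i) ℚᵘ.+ ℚ.toℚᵘ (toℚ j)
    ≈⟨ ℚᵘ.≃-sym (ℚ.toℚᵘ-homo-+ (toℚ i) (toℚ j)) ⟩
  ℚ.toℚᵘ (toℚ i ℚ.+ toℚ j)                   ∎)
  where
    open ℚᵘ.≃-Reasoning
    lemma : ∀ i j → (i ℤ.+ j) ℤ.* (+ 1 ℤ.* + 1) ≡ (i ℤ.* + 1 ℤ.+ j ℤ.* + 1) ℤ.* + 1
    lemma = solve-∀

toℚ-homo-* : ∀ i j → toℚ (i ℤ.* j) ≡ toℚ i ℚ.* toℚ j
toℚ-homo-* i j = ℚ.toℚᵘ-injective (begin
  ℚ.toℚᵘ (toℚ (i ℤ.* j))                     ≈⟨ toℚᵘ-toℚ (i ℤ.* j) ⟩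
  ℚᵘ.mkℚᵘ (i ℤ.* j) 0                        ≈⟨ ℚᵘ.*≡* (lemma i j) ⟩
  ℚᵘ.mkℚᵘ i 0 ℚᵘ.* ℚᵘ.mkℚᵘ j 0
    ≈⟨ ℚᵘ.*-cong (ℚᵘ.≃-sym (toℚᵘ-toℚ i)) (ℚᵘ.≃-sym (toℚᵘ-toℚ j)) ⟩
  ℚ.toℚᵘ (toℚ i) ℚᵘ.* ℚ.toℚᵘ (toℚ j)
    ≈⟨ ℚᵘ.≃-sym (ℚ.toℚᵘ-homo-* (toℚ i) (toℚ j)) ⟩
  ℚ.toℚᵘ (toℚ i ℚ.* toℚ j)                   ∎)
  where
    open ℚᵘ.≃-Reasoning
    lemma : ∀ i j → (i ℤ.* j) ℤ.* (+ 1 ℤ.* + 1) ≡ (i ℤ.* j) ℤ.* + 1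
    lemma = solve-∀

toℚ-suc : ∀ i → toℚ (ℤ.suc i) ≡ toℚ i ℚ.+ 1ℚ
toℚ-suc i = trans (toℚ-homo-+ (+ 1) i) (ℚ.+-comm 1ℚ (toℚ i))

-- Polynomials

infixl 6 _+P_
infixl 7 _*P_

_+P_ : Poly → Poly → Poly
[] +P q = q
(a ∷ p) +P [] = a ∷ p
(a ∷ p) +P (b ∷ q) = (a ℚ.+ b) ∷ (p +P q)

scaleP : ℚ → Poly → Poly
scaleP c = map (c ℚ.*_)

xP : Poly → Poly
xP [] = []
xP (a ∷ p) = 0ℚ ∷ a ∷ p

_*P_ : Poly → Poly → Poly
[] *P q = []
(c ∷ p) *P q = scaleP c q +P xP (p *P q)

module _ (x : ℚ) where
  open +-*-Solver

  evalP-+P : ∀ p q → evalP (p +P q) x ≡ evalP p x ℚ.+ evalP q x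
  evalP-+P [] q = sym (ℚ.+-identityˡ _)
  evalP-+P (a ∷ p) [] = sym (ℚ.+-identityʳ _)
  evalP-+P (a ∷ p) (b ∷ q) =
    trans (cong (λ z → (a ℚ.+ b) ℚ.+ x ℚ.* z) (evalP-+P p q)) (lemma a b (evalP p x) (evalP q x) x)
    where
      lemma : ∀ a b u v x → (a ℚ.+ b) ℚ.+ x ℚ.* (u ℚ.+ v) ≡ (a ℚ.+ x ℚ.* u) ℚ.+ (b ℚ.+ x ℚ.* v)
      lemma = solve 5 (λ a b u v x → (a :+ b) :+ x :* (u :+ v) := (a :+ x :* u) :+ (b :+ x :* v)) refl

  evalP-scaleP : ∀ c p → evalP (scaleP c p) x ≡ c ℚ.* evalP p x
  evalP-scaleP c [] = sym (ℚ.*-zeroʳ c)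
  evalP-scaleP c (a ∷ p) = trans (cong (λ z → c ℚ.* a ℚ.+ x ℚ.* z) (evalP-scaleP c p)) (lemma c a (evalP p x) x)
    where
      lemma : ∀ c a u x → c ℚ.* a ℚ.+ x ℚ.* (c ℚ.* u) ≡ c ℚ.* (a ℚ.+ x ℚ.* u)
      lemma = solve 4 (λ c a u x → c :* a :+ x :* (c :* u) := c :* (a :+ x :* u)) refl

  evalP-xP : ∀ p → evalP (xP p) x ≡ x ℚ.* evalP p x
  evalP-xP [] = sym (ℚ.*-zeroʳ x)
  evalP-xP (a ∷ p) = ℚ.+-identityˡ _

  evalP-*P : ∀ p q → evalP (p *P q) x ≡ evalP p x ℚ.* evalP q x
  evalP-*P [] q = sym (ℚ.*-zeroˡ (evalP q x))
  evalP-*P (c ∷ p) q = begin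
    evalP (scaleP c q +P xP (p *P q)) x                  ≡⟨ evalP-+P (scaleP c q) (xP (p *P q)) ⟩
    evalP (scaleP c q) x ℚ.+ evalP (xP (p *P q)) x
      ≡⟨ cong₂ ℚ._+_ (evalP-scaleP c q) (trans (evalP-xP (p *P q)) (cong (x ℚ.*_) (evalP-*P p q))) ⟩
    c ℚ.* evalP q x ℚ.+ x ℚ.* (evalP p x ℚ.* evalP q x)   ≡⟨ lemma c (evalP p x) (evalP q x) x ⟩
    (c ℚ.+ x ℚ.* evalP p x) ℚ.* evalP q x                 ∎
    where
      open ≡-Reasoning
      lemma : ∀ c u v x → c ℚ.* v ℚ.+ x ℚ.* (u ℚ.* v) ≡ (c ℚ.+ x ℚ.* u) ℚ.* v
      lemma = solve 4 (λ c u v x → c :* v :+ x :* (u :* v) := (c :+ x :* u) :* v) refl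

  module Evaluation = SumHomomorphism {_+_ = _+P_} {[]} {ℚ._+_} {0ℚ} (λ p → evalP p x) evalP-+P refl

module Poly∑ = Sum _+P_ []

length-+P : ∀ {d} p q → length p ≤ d → length q ≤ d → length (p +P q) ≤ d
length-+P [] q _ q≤d = q≤d
length-+P (a ∷ p) [] p≤d _ = p≤d
length-+P (a ∷ p) (b ∷ q) (s≤s p≤d) (s≤s q≤d) = s≤s (length-+P p q p≤d q≤d)

length-scaleP : ∀ {d} c p → length p ≤ d → length (scaleP c p) ≤ d
length-scaleP c p = subst (_≤ _) (sym (List.length-map (c ℚ.*_) p))

length-xP : ∀ {d} p → length p ≤ d → length (xP p) ≤ suc d
length-xP [] _ = z≤n
length-xP (a ∷ p) p≤d = s≤s p≤d

length-*P : ∀ {a b} p q → length p ≤ a → length q ≤ suc b → length (p *P q) ≤ a ℕ.+ b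
length-*P [] q _ _ = z≤n
length-*P {suc a} {b} (c ∷ p) q (s≤s p≤a) q≤1+b =
  length-+P (scaleP c q) (xP (p *P q)) (length-scaleP c q (ℕ.≤-trans q≤1+b (s≤s (ℕ.m≤n+m b a))))
            (length-xP (p *P q) (length-*P p q p≤a q≤1+b))

length-∑ : ∀ {A : Set} {d} {f : A → Poly} {xs} →
           All (λ x → length (f x) ≤ d) xs → length (Poly∑.∑ (map f xs)) ≤ d
length-∑ [] = z≤n
length-∑ {f = f} {x ∷ _} (fx≤d ∷ fxs≤d) = length-+P (f x) _ fx≤d (length-∑ fxs≤d)

-- The coefficients of (1 - q^n)^{-k}

module _ where
  open import Data.Rational using (_+_; _*_)
  open +-*-Solver
  open ≡-Reasoning

  ι : ℕ → ℚ
  ι j = toℚ (+ j)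

  ι-suc-nonZero : ∀ j → ℚ.NonZero (ι (suc j))
  ι-suc-nonZero j = ℚ.pos⇒nonZero (ι (suc j)) {{ℚ.normalize-pos (suc j) 1}}

  1/[1+_] : ℕ → ℚ
  1/[1+ j ] = (ℚ.1/ ι (suc j)) {{ι-suc-nonZero j}}

  1/[1+j]*[j+1] : ∀ j → 1/[1+ j ] * (ι j + 1ℚ) ≡ 1ℚ
  1/[1+j]*[j+1] j = trans (cong (1/[1+ j ] *_) (sym (toℚ-suc (+ j)))) (ℚ.*-inverseˡ (ι (suc j)) {{ι-suc-nonZero j}})

  -- multichooseP j = x (x + 1) ⋯ (x + j - 1) / j!
  multichooseP : ℕ → Poly
  multichooseP zero = 1ℚ ∷ []
  multichooseP (suc j) = scaleP 1/[1+ j ] (xP (multichooseP j) +P scaleP (ι j) (multichooseP j))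

  multichoose : ℕ → ℚ → ℚ
  multichoose j x = evalP (multichooseP j) x

  length-multichooseP : ∀ j → length (multichooseP j) ≤ suc j
  length-multichooseP zero = s≤s z≤n
  length-multichooseP (suc j) = length-scaleP 1/[1+ j ] (xP P +P scaleP (ι j) P)
    (length-+P (xP P) (scaleP (ι j) P) (length-xP P (length-multichooseP j))
               (length-scaleP (ι j) P (ℕ.m≤n⇒m≤1+n (length-multichooseP j))))
    where P = multichooseP j

  multichoose-zero : ∀ x → multichoose 0 x ≡ 1ℚ
  multichoose-zero x = trans (cong (_+_ 1ℚ) (ℚ.*-zeroʳ x)) (ℚ.+-identityʳ 1ℚ)

  multichoose-suc : ∀ j x → multichoose (suc j) x ≡ 1/[1+ j ] * (x * multichoose j x + ι j * multichoose j x)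
  multichoose-suc j x = trans (evalP-scaleP x 1/[1+ j ] (xP P +P scaleP (ι j) P)) (cong (1/[1+ j ] *_)
    (trans (evalP-+P x (xP P) (scaleP (ι j) P)) (cong₂ _+_ (evalP-xP x P) (evalP-scaleP x (ι j) P))))
    where P = multichooseP j

  multichoose-at-0 : ∀ j → multichoose (suc j) 0ℚ ≡ 0ℚ
  multichoose-at-0 j = trans (multichoose-suc j 0ℚ)
    (trans (cong (1/[1+ j ] *_) (cong₂ _+_ (ℚ.*-zeroˡ (multichoose j 0ℚ)) (ι*multichoose-at-0 j))) (ℚ.*-zeroʳ 1/[1+ j ]))
    where
      ι*multichoose-at-0 : ∀ j → ι j * multichoose j 0ℚ ≡ 0ℚ
      ι*multichoose-at-0 zero = ℚ.*-zeroˡ (multichoose 0 0ℚ)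
      ι*multichoose-at-0 (suc j) = trans (cong (ι (suc j) *_) (multichoose-at-0 j)) (ℚ.*-zeroʳ (ι (suc j)))

  x*multichoose[x+1] : ∀ j x → x * multichoose j (x + 1ℚ) ≡ (x + ι j) * multichoose j x
  x*multichoose[x+1] zero x = begin
    x * multichoose 0 (x + 1ℚ) ≡⟨ cong (x *_) (multichoose-zero (x + 1ℚ)) ⟩
    x * 1ℚ                     ≡⟨ solve 1 (λ x → x :* con 1ℚ := (x :+ con 0ℚ) :* con 1ℚ) refl x ⟩
    (x + 0ℚ) * 1ℚ              ≡⟨ cong ((x + 0ℚ) *_) (sym (multichoose-zero x)) ⟩
    (x + ι 0) * multichoose 0 x ∎
  x*multichoose[x+1] (suc j) x = begin
    x * multichoose (suc j) (x + 1ℚ)                ≡⟨ cong (x *_) (multichoose-suc j (x + 1ℚ)) ⟩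
    x * (c * ((x + 1ℚ) * u + ι j * u))              ≡⟨ lemma₁ x c (ι j) u ⟩
    c * ((x + 1ℚ + ι j) * (x * u))                  ≡⟨ cong (λ z → c * ((x + 1ℚ + ι j) * z)) (x*multichoose[x+1] j x) ⟩
    c * ((x + 1ℚ + ι j) * ((x + ι j) * v))          ≡⟨ lemma₂ x c (ι j) v ⟩
    (x + (ι j + 1ℚ)) * (c * (x * v + ι j * v))
      ≡⟨ cong₂ (λ p q → (x + p) * q) (sym (toℚ-suc (+ j))) (sym (multichoose-suc j x)) ⟩
    (x + ι (suc j)) * multichoose (suc j) x         ∎
    where
      c = 1/[1+ j ]
      u = multichoose j (x + 1ℚ)
      v = multichoose j x
      lemma₁ : ∀ x c i u → x * (c * ((x + 1ℚ) * u + i * u)) ≡ c * ((x + 1ℚ + i) * (x * u))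
      lemma₁ = solve 4 (λ x c i u → x :* (c :* ((x :+ con 1ℚ) :* u :+ i :* u))
                                 := c :* ((x :+ con 1ℚ :+ i) :* (x :* u))) refl
      lemma₂ : ∀ x c i v → c * ((x + 1ℚ + i) * ((x + i) * v)) ≡ (x + (i + 1ℚ)) * (c * (x * v + i * v))
      lemma₂ = solve 4 (λ x c i v → c :* ((x :+ con 1ℚ :+ i) :* ((x :+ i) :* v))
                                 := (x :+ (i :+ con 1ℚ)) :* (c :* (x :* v :+ i :* v))) refl

  multichoose-pascal : ∀ j x → multichoose (suc j) (x + 1ℚ) ≡ multichoose (suc j) x + multichoose j (x + 1ℚ)
  multichoose-pascal j x = begin
    multichoose (suc j) (x + 1ℚ)                     ≡⟨ multichoose-suc j (x + 1ℚ) ⟩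
    c * ((x + 1ℚ) * u + ι j * u)                     ≡⟨ lemma₁ c x (ι j) u ⟩
    c * (x * u) + (c * (ι j + 1ℚ)) * u
      ≡⟨ cong₂ (λ p q → c * p + q * u) (x*multichoose[x+1] j x) (1/[1+j]*[j+1] j) ⟩
    c * ((x + ι j) * v) + 1ℚ * u                     ≡⟨ lemma₂ c x (ι j) u v ⟩
    c * (x * v + ι j * v) + u                        ≡⟨ cong (_+ u) (sym (multichoose-suc j x)) ⟩
    multichoose (suc j) x + u                        ∎
    where
      c = 1/[1+ j ]
      u = multichoose j (x + 1ℚ)
      v = multichoose j x
      lemma₁ : ∀ c x i u → c * ((x + 1ℚ) * u + i * u) ≡ c * (x * u) + (c * (i + 1ℚ)) * u
      lemma₁ = solve 4 (λ c x i u → c :* ((x :+ con 1ℚ) :* u :+ i :* u) := c :* (x :* u) :+ (c :* (i :+ con 1ℚ)) :* u) refl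
      lemma₂ : ∀ c x i u v → c * ((x + i) * v) + 1ℚ * u ≡ c * (x * v + i * v) + u
      lemma₂ = solve 5 (λ c x i u v → c :* ((x :+ i) :* v) :+ con 1ℚ :* u := c :* (x :* v :+ i :* v) :+ u) refl

-- f = g / (1 - q^n), in the coefficientwise form f = g + q^n f.
record _≈_/[1-q^_] (f g : ℕ → ℚ) (n : ℕ) : Set where
  field
    below : ∀ N → N < n → f N ≡ g N
    above : ∀ M → f (n ℕ.+ M) ≡ g (n ℕ.+ M) ℚ.+ f M

open _≈_/[1-q^_]

module _ {n : ℕ} .{{_ : ℕ.NonZero n}} {f f′ g g′ : ℕ → ℚ}
         (f/ : f ≈ g /[1-q^ n ]) (f′/ : f′ ≈ g′ /[1-q^ n ]) where

  quotient-unique : (∀ N → g N ≡ g′ N) → ∀ N → f N ≡ f′ N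
  quotient-unique g≗g′ = <-rec (λ N → f N ≡ f′ N) step
    where
      step : ∀ N → (∀ {M} → M < N → f M ≡ f′ M) → f N ≡ f′ N
      step N ih with <-or-+ n N
      ... | inj₁ N<n = trans (below f/ N N<n) (trans (g≗g′ N) (sym (below f′/ N N<n)))
      ... | inj₂ (M , refl) = trans (above f/ M)
        (trans (cong₂ ℚ._+_ (g≗g′ (n ℕ.+ M)) (ih (ℕ.m<n+m M (ℕ.>-nonZero⁻¹ n)))) (sym (above f′/ M)))

  numerator-unique : (∀ N → f N ≡ f′ N) → ∀ N → g N ≡ g′ N
  numerator-unique f≗f′ N with <-or-+ n N
  ... | inj₁ N<n = trans (sym (below f/ N N<n)) (trans (f≗f′ N) (below f′/ N N<n))
  ... | inj₂ (M , refl) = +-cancelʳ (f M) (g (n ℕ.+ M)) (g′ (n ℕ.+ M))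
    (trans (sym (above f/ M)) (trans (f≗f′ (n ℕ.+ M))
      (trans (above f′/ M) (cong (g′ (n ℕ.+ M) ℚ.+_) (sym (f≗f′ M))))))

shift-rec⇒quotient : ∀ n {f g : Series} → (∀ N → f N ≡ (g ⊕ shift n f) N) →
                     (toℚ ∘ f) ≈ (toℚ ∘ g) /[1-q^ n ]
shift-rec⇒quotient n {f} {g} rec = record
  { below = λ N N<n →
      cong toℚ (trans (rec N) (trans (cong (ℤ._+_ (g N)) (shift-< n f N N<n)) (ℤ.+-identityʳ (g N))))
  ; above = λ M → trans (cong toℚ (trans (rec (n ℕ.+ M)) (cong (ℤ._+_ (g (n ℕ.+ M))) (shift-+ n f M))))
                        (toℚ-homo-+ (g (n ℕ.+ M)) (f M))
  }

length-if : ∀ {d} b (p : Poly) → length p ≤ d → length (if b then p else []) ≤ d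
length-if true p p≤d = p≤d
length-if false p _ = z≤n

-- The coefficient of q^N in (1 - q^n)^{-x}, as a polynomial in x.
invPowP : ℕ → ℕ → Poly
invPowP n N = Poly∑.dilate n multichooseP N

length-invPowP : ∀ n N → length (invPowP n N) ≤ suc N
length-invPowP n N = length-∑ {f = λ j → if ⌊ n ℕ.* j ℕ.≟ N ⌋ then multichooseP j else []}
  (All.applyUpTo⁺₁ (λ j → j) (suc N) (λ {j} j≤N →
  length-if ⌊ n ℕ.* j ℕ.≟ N ⌋ (multichooseP j) (ℕ.≤-trans (length-multichooseP j) j≤N)))

module _ (n : ℕ) .{{_ : ℕ.NonZero n}} where

  -- (1 - q^n)^{-x} = Σ_j (x + j - 1 choose j) q^{n j}
  binomialSeries : ℚ → ℕ → ℚ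
  binomialSeries x = ℚ∑.dilate n (λ j → multichoose j x)

  binomialSeries-quotient : ∀ x → binomialSeries (x ℚ.+ 1ℚ) ≈ binomialSeries x /[1-q^ n ]
  binomialSeries-quotient x = record
    { below = λ N N<n → trans (split N) (trans (cong (binomialSeries x N ℚ.+_) (ℚ∑.dilate-vanish n δ N refl N<n))
                                              (ℚ.+-identityʳ _))
    ; above = λ M → trans (split (n ℕ.+ M)) (cong (binomialSeries x (n ℕ.+ M) ℚ.+_) (ℚ∑.dilate-shift n δ M))
    }
    where
      δ : ℕ → ℚ
      δ zero = 0ℚ
      δ (suc j) = multichoose j (x ℚ.+ 1ℚ)
      pascal : ∀ j → multichoose j (x ℚ.+ 1ℚ) ≡ multichoose j x ℚ.+ δ j
      pascal zero = trans (multichoose-zero (x ℚ.+ 1ℚ)) (sym (trans (ℚ.+-identityʳ _) (multichoose-zero x)))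
      pascal (suc j) = multichoose-pascal j x
      split : ∀ N → binomialSeries (x ℚ.+ 1ℚ) N ≡ binomialSeries x N ℚ.+ ℚ∑.dilate n δ N
      split N = trans (ℚ∑.dilate-cong n N pascal) (ℚ∑.dilate-+ n (λ j → multichoose j x) δ N)

  invPowS-quotient : ∀ k → (toℚ ∘ invPowS n (ℤ.suc k)) ≈ (toℚ ∘ invPowS n k) /[1-q^ n ]
  invPowS-quotient k = shift-rec⇒quotient n {invPowS n (ℤ.suc k)} {invPowS n k} (invPowS-suc-rec n k)

  binomialSeries-suc : ∀ k → binomialSeries (toℚ (ℤ.suc k)) ≈ binomialSeries (toℚ k) /[1-q^ n ]
  binomialSeries-suc k = subst (λ y → binomialSeries y ≈ binomialSeries (toℚ k) /[1-q^ n ]) (sym (toℚ-suc k))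
                               (binomialSeries-quotient (toℚ k))

  invPowS≗binomialSeries-+ : ∀ m N → toℚ (invPowS n (+ m) N) ≡ binomialSeries (toℚ (+ m)) N
  invPowS≗binomialSeries-+ zero zero = sym (trans (ℚ∑.dilate-zero n (λ j → multichoose j 0ℚ)) (multichoose-zero 0ℚ))
  invPowS≗binomialSeries-+ zero (suc N) = sym (ℚ∑.dilate-supported-at-0 n (λ j → multichoose j 0ℚ) N multichoose-at-0)
  invPowS≗binomialSeries-+ (suc m) =
    quotient-unique (invPowS-quotient (+ m)) (binomialSeries-suc (+ m)) (invPowS≗binomialSeries-+ m)

  invPowS≗binomialSeries-− : ∀ m N → toℚ (invPowS n -[1+ m ] N) ≡ binomialSeries (toℚ -[1+ m ]) N
  invPowS≗binomialSeries-− zero =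
    numerator-unique (invPowS-quotient -[1+ 0 ]) (binomialSeries-suc -[1+ 0 ]) (invPowS≗binomialSeries-+ 0)
  invPowS≗binomialSeries-− (suc m) =
    numerator-unique (invPowS-quotient -[1+ suc m ]) (binomialSeries-suc -[1+ suc m ]) (invPowS≗binomialSeries-− m)

  invPowS≗binomialSeries : ∀ k N → toℚ (invPowS n k N) ≡ binomialSeries (toℚ k) N
  invPowS≗binomialSeries (+ m) = invPowS≗binomialSeries-+ m
  invPowS≗binomialSeries -[1+ m ] = invPowS≗binomialSeries-− m

  evalP-invPowP : ∀ k N → evalP (invPowP n N) (toℚ k) ≡ toℚ (invPowS n k N)
  evalP-invPowP k N = trans (Evaluation.dilate-homo (toℚ k) n multichooseP N) (sym (invPowS≗binomialSeries k N))

module Toℚ = SumHomomorphism {_+_ = ℤ._+_} {+ 0} {ℚ._+_} {0ℚ} toℚ toℚ-homo-+ refl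

-- The coefficient of q^ℓ in Π_{n ∈ t} (1 - q^n)^{-x}, as a polynomial in x.
prodInvPowP : List ℕ → ℕ → Poly
prodInvPowP [] zero = 1ℚ ∷ []
prodInvPowP [] (suc ℓ) = []
prodInvPowP (n ∷ t) ℓ = Poly∑.∑ (map (λ i → invPowP n i *P prodInvPowP t (ℓ ℕ.∸ i)) (upTo (suc ℓ)))

length-prodInvPowP : ∀ t ℓ → length (prodInvPowP t ℓ) ≤ suc ℓ
length-prodInvPowP [] zero = s≤s z≤n
length-prodInvPowP [] (suc ℓ) = z≤n
length-prodInvPowP (n ∷ t) ℓ = length-∑ {f = λ i → invPowP n i *P prodInvPowP t (ℓ ℕ.∸ i)}
  (All.applyUpTo⁺₁ (λ i → i) (suc ℓ) (λ {i} i≤ℓ →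
    subst (length (invPowP n i *P prodInvPowP t (ℓ ℕ.∸ i)) ≤_) (cong suc (ℕ.m+[n∸m]≡n (ℕ.≤-pred i≤ℓ)))
      (length-*P (invPowP n i) (prodInvPowP t (ℓ ℕ.∸ i)) (length-invPowP n i) (length-prodInvPowP t (ℓ ℕ.∸ i)))))

evalP-prodInvPowP : ∀ k t → All (1 ≤_) t → ∀ ℓ →
  evalP (prodInvPowP t ℓ) (toℚ k) ≡ toℚ (prodS (map (λ n → invPowS n k) t) ℓ)
evalP-prodInvPowP k [] [] zero = trans (cong (ℚ._+_ 1ℚ) (ℚ.*-zeroʳ (toℚ k))) (ℚ.+-identityʳ 1ℚ)
evalP-prodInvPowP k [] [] (suc ℓ) = refl
evalP-prodInvPowP k (suc n ∷ t) (s≤s z≤n ∷ t≥1) ℓ = begin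
  evalP (Poly∑.∑ (map F (upTo (suc ℓ)))) x
    ≡⟨ Evaluation.∑-map-homo x F (upTo (suc ℓ)) ⟩
  ℚ∑.∑ (map (λ i → evalP (F i) x) (upTo (suc ℓ)))
    ≡⟨ ℚ∑.∑-map-cong (upTo (suc ℓ)) (λ i → trans (evalP-*P x (invPowP (suc n) i) _)
         (trans (cong₂ ℚ._*_ (evalP-invPowP (suc n) k i) (evalP-prodInvPowP k t t≥1 (ℓ ℕ.∸ i)))
                (sym (toℚ-homo-* (invPowS (suc n) k i) (T (ℓ ℕ.∸ i)))))) ⟩
  ℚ∑.∑ (map (λ i → toℚ (invPowS (suc n) k i ℤ.* T (ℓ ℕ.∸ i))) (upTo (suc ℓ)))
    ≡⟨ sym (Toℚ.∑-map-homo (λ i → invPowS (suc n) k i ℤ.* T (ℓ ℕ.∸ i)) (upTo (suc ℓ))) ⟩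
  toℚ ((invPowS (suc n) k ⊛ T) ℓ) ∎
  where
    open ≡-Reasoning
    x = toℚ k
    F = λ i → invPowP (suc n) i *P prodInvPowP t (ℓ ℕ.∸ i)
    T = prodS (map (λ n → invPowS n k) t)

-- Strictly increasing tuples

sumSq : List ℕ → ℕ
sumSq t = sum (map (λ n → n ℕ.* n) t)

module _ where
  open import Data.Nat using (_+_; _*_)
  open ℕ.≤-Reasoning

  2u[u+d]≤u²+[u+d]² : ∀ u d → 2 * (u * (u + d)) ≤ u * u + (u + d) * (u + d)
  2u[u+d]≤u²+[u+d]² u d = subst (2 * (u * (u + d)) ≤_) (eq u d) (ℕ.m≤m+n _ (d * d))
    where
      eq : ∀ u d → 2 * (u * (u + d)) + d * d ≡ u * u + (u + d) * (u + d)
      eq = ℕ-Solver.solve-∀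

  2uv≤u²+v² : ∀ u v → 2 * (u * v) ≤ u * u + v * v
  2uv≤u²+v² u v with ℕ.≤-total u v
  ... | inj₁ u≤v = subst (λ v → 2 * (u * v) ≤ u * u + v * v) (ℕ.m+[n∸m]≡n u≤v) (2u[u+d]≤u²+[u+d]² u (v ℕ.∸ u))
  ... | inj₂ v≤u = subst (λ u → 2 * (u * v) ≤ u * u + v * v) (ℕ.m+[n∸m]≡n v≤u)
    (subst₂ (λ l r → 2 * l ≤ r) (ℕ.*-comm v _) (ℕ.+-comm (v * v) _) (2u[u+d]≤u²+[u+d]² v (u ℕ.∸ v)))

  2Sx≤Q+ax² : ∀ a S Q x → S * S ≤ a * Q → 2 * (S * x) ≤ Q + a * (x * x)
  2Sx≤Q+ax² zero zero Q x _ = z≤n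
  2Sx≤Q+ax² (suc a′) S Q x S²≤aQ = ℕ.*-cancelˡ-≤ (suc a′) (begin
    a * (2 * (S * x))          ≡⟨ eq₁ a S x ⟩
    2 * (S * (a * x))          ≤⟨ 2uv≤u²+v² S (a * x) ⟩
    S * S + (a * x) * (a * x)  ≤⟨ ℕ.+-monoˡ-≤ ((a * x) * (a * x)) S²≤aQ ⟩
    a * Q + (a * x) * (a * x)  ≡⟨ eq₂ a Q x ⟩
    a * (Q + a * (x * x))      ∎)
    where
      a = suc a′
      eq₁ : ∀ a S x → a * (2 * (S * x)) ≡ 2 * (S * (a * x))
      eq₁ = ℕ-Solver.solve-∀
      eq₂ : ∀ a Q x → a * Q + (a * x) * (a * x) ≡ a * (Q + a * (x * x))
      eq₂ = ℕ-Solver.solve-∀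

  sum²≤length*sumSq : ∀ t → sum t * sum t ≤ length t * sumSq t
  sum²≤length*sumSq [] = z≤n
  sum²≤length*sumSq (x ∷ t) = begin
    (x + S) * (x + S)                      ≡⟨ eq₁ x S ⟩
    x * x + 2 * (S * x) + S * S            ≤⟨ ℕ.+-mono-≤ (ℕ.+-monoʳ-≤ (x * x) (2Sx≤Q+ax² a S Q x IH)) IH ⟩
    x * x + (Q + a * (x * x)) + a * Q      ≡⟨ eq₂ a Q x ⟩
    suc a * (x * x + Q)                    ∎
    where
      S = sum t
      Q = sumSq t
      a = length t
      IH = sum²≤length*sumSq t
      eq₁ : ∀ x S → (x + S) * (x + S) ≡ x * x + 2 * (S * x) + S * S
      eq₁ = ℕ-Solver.solve-∀
      eq₂ : ∀ a Q x → x * x + (Q + a * (x * x)) + a * Q ≡ suc a * (x * x + Q)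
      eq₂ = ℕ-Solver.solve-∀

  sumSq≤sum² : ∀ t → sumSq t ≤ sum t * sum t
  sumSq≤sum² [] = z≤n
  sumSq≤sum² (x ∷ t) = begin
    x * x + sumSq t                        ≤⟨ ℕ.+-monoʳ-≤ (x * x) (sumSq≤sum² t) ⟩
    x * x + S * S                          ≤⟨ ℕ.+-monoˡ-≤ (S * S) (ℕ.m≤m+n (x * x) (2 * (x * S))) ⟩
    x * x + 2 * (x * S) + S * S            ≡⟨ eq x S ⟩
    (x + S) * (x + S)                      ∎
    where
      S = sum t
      eq : ∀ x S → x * x + 2 * (x * S) + S * S ≡ (x + S) * (x + S)
      eq = ℕ-Solver.solve-∀

-- The bound a ≤ N makes the triangular bound inductive: the entry appended next is N + 1 ≥ a + 1.
record IsIncTuple (a N : ℕ) (t : List ℕ) : Set where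
  field
    a≤N : a ≤ N
    positive : All (1 ≤_) t
    length≡a : length t ≡ a
    triangular : a ℕ.* suc a ≤ 2 ℕ.* sum t

open IsIncTuple

sum-∷ʳ : ∀ t x → sum (t ++ [ x ]) ≡ sum t ℕ.+ x
sum-∷ʳ t x = trans (sum-++ t [ x ]) (cong (sum t ℕ.+_) (ℕ.+-identityʳ x))

IsIncTuple-∷ʳ : ∀ {a N t} → IsIncTuple a N t → IsIncTuple (suc a) (suc N) (t ++ [ suc N ])
IsIncTuple-∷ʳ {a} {N} {t} p = record
  { a≤N = s≤s (a≤N p)
  ; positive = All.++⁺ (positive p) (s≤s z≤n ∷ [])
  ; length≡a = trans (List.length-++ t) (trans (cong (ℕ._+ 1) (length≡a p)) (ℕ.+-comm a 1))
  ; triangular = begin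
      suc a ℕ.* suc (suc a)               ≡⟨ eq a ⟩
      a ℕ.* suc a ℕ.+ 2 ℕ.* suc a         ≤⟨ ℕ.+-mono-≤ (triangular p) (ℕ.*-monoʳ-≤ 2 (s≤s (a≤N p))) ⟩
      2 ℕ.* sum t ℕ.+ 2 ℕ.* suc N         ≡⟨ sym (ℕ.*-distribˡ-+ 2 (sum t) (suc N)) ⟩
      2 ℕ.* (sum t ℕ.+ suc N)             ≡⟨ cong (2 ℕ.*_) (sym (sum-∷ʳ t (suc N))) ⟩
      2 ℕ.* sum (t ++ [ suc N ])          ∎
  }
  where
    open ℕ.≤-Reasoning
    eq : ∀ a → suc a ℕ.* suc (suc a) ≡ a ℕ.* suc a ℕ.+ 2 ℕ.* suc a
    eq = ℕ-Solver.solve-∀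

IsIncTuple-weaken : ∀ {a N t} → IsIncTuple a N t → IsIncTuple a (suc N) t
IsIncTuple-weaken p = record
  { a≤N = ℕ.m≤n⇒m≤1+n (a≤N p) ; positive = positive p ; length≡a = length≡a p ; triangular = triangular p }

incTuples-isIncTuple : ∀ a N → All (IsIncTuple a N) (incTuples a N)
incTuples-isIncTuple zero N = record { a≤N = z≤n ; positive = [] ; length≡a = refl ; triangular = z≤n } ∷ []
incTuples-isIncTuple (suc a) zero = []
incTuples-isIncTuple (suc a) (suc N) = All.++⁺
  (All.map IsIncTuple-weaken (incTuples-isIncTuple (suc a) N))
  (All.map⁺ (All.map IsIncTuple-∷ʳ (incTuples-isIncTuple a N)))

-- The coefficients of 𝒜 and ℬ

∑-upTo-shift : ∀ N W (T : Series) →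
  ∑[ ℓ ≤ N ] (if ⌊ W ℕ.+ ℓ ℕ.≟ N ⌋ then toℚ (T ℓ) else 0ℚ) ≡ toℚ (shift W T N)
∑-upTo-shift N W T with <-or-+ W N
... | inj₁ N<W = trans (ℚ∑.∑-upTo-zero (suc N) (λ ℓ _ → ℚ∑.if-≢ (toℚ (T ℓ))
                         (λ W+ℓ≡N → ℕ.<⇒≱ N<W (subst (W ≤_) W+ℓ≡N (ℕ.m≤m+n W ℓ)))))
                       (sym (cong toℚ (shift-< W T N N<W)))
... | inj₂ (M , refl) = trans (ℚ∑.∑-upTo-single (suc (W ℕ.+ M)) M _ (s≤s (ℕ.m≤n+m M W))
                                (λ ℓ ℓ≢M → ℚ∑.if-≢ (toℚ (T ℓ)) (ℓ≢M ∘ ℕ.+-cancelˡ-≡ W ℓ M)))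
                              (trans (ℚ∑.if-≡ (toℚ (T M)) refl) (sym (cong toℚ (shift-+ W T M))))

evalP-prodInvPowP-shift : ∀ (w : ℕ → ℕ) k t → All (1 ≤_) t → ∀ N →
  ∑[ ℓ ≤ N ] (if ⌊ sum (map w t) ℕ.+ ℓ ℕ.≟ N ⌋ then evalP (prodInvPowP t ℓ) (toℚ k) else 0ℚ)
    ≡ toℚ (prodS (map (λ n → monoS (w n) ⊛ invPowS n k) t) N)
evalP-prodInvPowP-shift w k t t≥1 N =
  trans (ℚ∑.∑-map-cong (upTo (suc N)) (λ ℓ →
           cong (if ⌊ W ℕ.+ ℓ ℕ.≟ N ⌋ then_else 0ℚ) (evalP-prodInvPowP k t t≥1 ℓ)))
        (trans (∑-upTo-shift N W T) (cong toℚ (sym (prodS-monoS w (λ n → invPowS n k) t N))))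
  where
    W = sum (map w t)
    T = prodS (map (λ n → invPowS n k) t)

∑-incTuples-suc : ∀ a {n N} (g : List ℕ → ℚ) → n ≤ N → (∀ t → n < sum t → g t ≡ 0ℚ) →
  ∑[ t ∈ incTuples a (suc N) ] g t ≡ ∑[ t ∈ incTuples a N ] g t
∑-incTuples-suc zero g _ _ = refl
∑-incTuples-suc (suc a) {n} {N} g n≤N g≗0 = begin
  ∑[ t ∈ incTuples (suc a) N ++ map (_++ [ suc N ]) (incTuples a N) ] g t
    ≡⟨ cong ℚ∑.∑ (List.map-++ g (incTuples (suc a) N) _) ⟩
  ℚ∑.∑ (map g (incTuples (suc a) N) ++ map g (map (_++ [ suc N ]) (incTuples a N)))
    ≡⟨ ℚ∑.∑-++ (map g (incTuples (suc a) N)) _ ⟩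
  (∑[ t ∈ incTuples (suc a) N ] g t) ℚ.+ (∑[ t ∈ map (_++ [ suc N ]) (incTuples a N) ] g t)
    ≡⟨ cong ((∑[ t ∈ incTuples (suc a) N ] g t) ℚ.+_)
            (trans (cong ℚ∑.∑ (sym (List.map-∘ (incTuples a N)))) (ℚ∑.∑-map-zero (incTuples a N) new≗0)) ⟩
  (∑[ t ∈ incTuples (suc a) N ] g t) ℚ.+ 0ℚ
    ≡⟨ ℚ.+-identityʳ _ ⟩
  ∑[ t ∈ incTuples (suc a) N ] g t ∎
  where
    open ≡-Reasoning
    new≗0 : ∀ t → g (t ++ [ suc N ]) ≡ 0ℚ
    new≗0 t = g≗0 _ (subst (n <_) (sym (sum-∷ʳ t (suc N))) (ℕ.<-≤-trans (s≤s n≤N) (ℕ.m≤n+m (suc N) (sum t))))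

∑-incTuples-mono : ∀ a {n} N (g : List ℕ → ℚ) → n ≤ N → (∀ t → n < sum t → g t ≡ 0ℚ) →
  ∑[ t ∈ incTuples a n ] g t ≡ ∑[ t ∈ incTuples a N ] g t
∑-incTuples-mono a zero g z≤n _ = refl
∑-incTuples-mono a (suc N) g n≤1+N g≗0 with ℕ.m≤n⇒m<n∨m≡n n≤1+N
... | inj₁ (s≤s n≤N) = trans (∑-incTuples-mono a N g n≤N g≗0) (sym (∑-incTuples-suc a g n≤N g≗0))
... | inj₂ refl = refl

tuplePoly : ℕ → ℕ → (List ℕ → Bool) → ℕ → Poly
tuplePoly a n p ℓ = Poly∑.∑ (map (λ t → if p t then prodInvPowP t ℓ else []) (incTuples a n))

length-tuplePoly : ∀ a n p ℓ → length (tuplePoly a n p ℓ) ≤ suc ℓ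
length-tuplePoly a n p ℓ = length-∑ {f = λ t → if p t then prodInvPowP t ℓ else []}
  (All.universal (λ t → length-if (p t) (prodInvPowP t ℓ) (length-prodInvPowP t ℓ)) (incTuples a n))

evalP-tuplePoly : ∀ a {n} N p ℓ x c → n ≤ N → (∀ t → n < sum t → p t ≡ false) →
  (if c then evalP (tuplePoly a n p ℓ) x else 0ℚ)
    ≡ ∑[ t ∈ incTuples a N ] (if c then (if p t then evalP (prodInvPowP t ℓ) x else 0ℚ) else 0ℚ)
evalP-tuplePoly a {n} N p ℓ x c n≤N p≗false = begin
  (if c then evalP (tuplePoly a n p ℓ) x else 0ℚ)
    ≡⟨ cong (if c then_else 0ℚ) (trans (Evaluation.∑-map-homo x _ (incTuples a n))
                                       (ℚ∑.∑-map-cong (incTuples a n) (λ t → Evaluation.if-homo x (p t) _))) ⟩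
  (if c then ∑[ t ∈ incTuples a n ] (if p t then E t else 0ℚ) else 0ℚ)
    ≡⟨ ℚ∑.∑-map-if c (λ t → if p t then E t else 0ℚ) (incTuples a n) ⟩
  ∑[ t ∈ incTuples a n ] (if c then (if p t then E t else 0ℚ) else 0ℚ)
    ≡⟨ ∑-incTuples-mono a N _ n≤N (λ t n<Σt → trans (cong (λ b → if c then (if b then E t else 0ℚ) else 0ℚ)
                                                          (p≗false t n<Σt))
                                                    (ℚ∑.if-0# c)) ⟩
  ∑[ t ∈ incTuples a N ] (if c then (if p t then E t else 0ℚ) else 0ℚ) ∎
  where
    open ≡-Reasoning
    E = λ t → evalP (prodInvPowP t ℓ) x

∧-false : ∀ b {c} → c ≡ false → b ∧ c ≡ false
∧-false b refl = Bool.∧-zeroʳ b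

sum-map-*ˡ : ∀ r t → sum (map (r ℕ.*_) t) ≡ sum t ℕ.* r
sum-map-*ˡ r [] = refl
sum-map-*ˡ r (n ∷ t) = trans (cong (r ℕ.* n ℕ.+_) (sum-map-*ˡ r t))
  (trans (cong (ℕ._+ sum t ℕ.* r) (ℕ.*-comm r n)) (sym (ℕ.*-distribʳ-+ r n (sum t))))

sum-map-r*n²+s*n : ∀ r s t →
  sum (map (λ n → r ℕ.* (n ℕ.* n) ℕ.+ s ℕ.* n) t) ≡ sumSq t ℕ.* r ℕ.+ sum t ℕ.* s
sum-map-r*n²+s*n r s [] = refl
sum-map-r*n²+s*n r s (n ∷ t) =
  trans (cong (r ℕ.* (n ℕ.* n) ℕ.+ s ℕ.* n ℕ.+_) (sum-map-r*n²+s*n r s t)) (eq r s n (sumSq t) (sum t))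
  where
    open import Data.Nat using (_+_; _*_)
    eq : ∀ r s n Q S → r * (n * n) + s * n + (Q * r + S * s) ≡ (n * n + Q) * r + (n + S) * s
    eq = ℕ-Solver.solve-∀

-- Every tuple with n₁ + ⋯ + n_a = n has n_a ≤ n, so it occurs in incTuples a n.
polyA : ℕ → ℕ → ℕ → Poly
polyA a ℓ n = tuplePoly a n (λ t → ⌊ sum t ℕ.≟ n ⌋) ℓ

polyB : ℕ → ℕ → ℕ → ℕ → Poly
polyB a ℓ m n = tuplePoly a n (λ t → ⌊ sum t ℕ.≟ n ⌋ ∧ ⌊ sumSq t ℕ.≟ m ⌋) ℓ

module _ (a : ℕ) (k : ℤ) (r N : ℕ) .{{_ : ℕ.NonZero r}} where
  private
    E : List ℕ → ℕ → ℚ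
    E t ℓ = evalP (prodInvPowP t ℓ) (toℚ k)

    cond : ℕ → ℕ → Bool
    cond ℓ n = ⌊ a ℕ.* suc a ℕ.≤? 2 ℕ.* n ⌋ ∧ ⌊ n ℕ.* r ℕ.+ ℓ ℕ.≟ N ⌋

    summand : ℕ → ℕ → List ℕ → ℚ
    summand ℓ n t = if cond ℓ n then (if ⌊ sum t ℕ.≟ n ⌋ then E t ℓ else 0ℚ) else 0ℚ

    cond-false : ∀ ℓ n → N < n → cond ℓ n ≡ false
    cond-false ℓ n N<n = ∧-false _ (⌊⌋-no (n ℕ.* r ℕ.+ ℓ ℕ.≟ N) (λ e → ℕ.<⇒≱ N<n
      (ℕ.≤-trans (ℕ.m≤m*n n r) (subst (n ℕ.* r ≤_) e (ℕ.m≤m+n (n ℕ.* r) ℓ)))))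

    ∑-summand≡termA : ∀ t → IsIncTuple a N t →
      ∑[ ℓ ≤ N ] ∑[ n ≤ N ] summand ℓ n t ≡ toℚ (termA k r t N)
    ∑-summand≡termA t p = begin
      ∑[ ℓ ≤ N ] ∑[ n ≤ N ] summand ℓ n t
        ≡⟨ ℚ∑.∑-map-cong U collapse-n ⟩
      ∑[ ℓ ≤ N ] (if cond ℓ (sum t) then E t ℓ else 0ℚ)
        ≡⟨ ℚ∑.∑-map-cong U (λ ℓ → cong (λ b → if b ∧ ⌊ sum t ℕ.* r ℕ.+ ℓ ℕ.≟ N ⌋ then E t ℓ else 0ℚ)
                                       (⌊⌋-yes (a ℕ.* suc a ℕ.≤? 2 ℕ.* sum t) (triangular p))) ⟩
      ∑[ ℓ ≤ N ] (if ⌊ sum t ℕ.* r ℕ.+ ℓ ℕ.≟ N ⌋ then E t ℓ else 0ℚ)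
        ≡⟨ cong (λ W → ∑[ ℓ ≤ N ] (if ⌊ W ℕ.+ ℓ ℕ.≟ N ⌋ then E t ℓ else 0ℚ)) (sym (sum-map-*ˡ r t)) ⟩
      ∑[ ℓ ≤ N ] (if ⌊ sum (map (r ℕ.*_) t) ℕ.+ ℓ ℕ.≟ N ⌋ then E t ℓ else 0ℚ)
        ≡⟨ evalP-prodInvPowP-shift (r ℕ.*_) k t (positive p) N ⟩
      toℚ (termA k r t N) ∎
      where
        open ≡-Reasoning
        U = upTo (suc N)

        collapse-n : ∀ ℓ → ∑[ n ≤ N ] summand ℓ n t ≡ (if cond ℓ (sum t) then E t ℓ else 0ℚ)
        collapse-n ℓ = trans (ℚ∑.∑-map-cong U (λ n → ℚ∑.if-swap ⌊ sum t ℕ.≟ n ⌋ (cond ℓ n) (E t ℓ)))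
          (ℚ∑.∑-upTo-collapse N (sum t) (λ n → if cond ℓ n then E t ℓ else 0ℚ)
            (λ N<Σt → cong (if_then E t ℓ else 0ℚ) (cond-false ℓ (sum t) N<Σt)))

  coeffA≡rhsA : toℚ (coeffA a k r N) ≡ rhsA a (polyA a) k r N
  coeffA≡rhsA = sym (begin
    rhsA a (polyA a) k r N
      ≡⟨ ℚ∑.∑-concatMap (λ ℓ → map (rhsSummand ℓ) U) U ⟩
    ∑[ ℓ ≤ N ] ∑[ n ≤ N ] rhsSummand ℓ n
      ≡⟨ ℚ∑.∑-map-cong U (λ ℓ → ℚ∑.∑-upTo-cong (suc N) (λ n n≤N →
           evalP-tuplePoly a N (λ t → ⌊ sum t ℕ.≟ n ⌋) ℓ (toℚ k) (cond ℓ n) (ℕ.≤-pred n≤N)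
             (λ t n<Σt → ⌊⌋-no (sum t ℕ.≟ n) (ℕ.<⇒≢ n<Σt ∘ sym)))) ⟩
    ∑[ ℓ ≤ N ] ∑[ n ≤ N ] ∑[ t ∈ I ] summand ℓ n t
      ≡⟨ ℚ∑.∑-map-cong U (λ ℓ → ℚ∑.∑-map-swap (summand ℓ) U I) ⟩
    ∑[ ℓ ≤ N ] ∑[ t ∈ I ] ∑[ n ≤ N ] summand ℓ n t
      ≡⟨ ℚ∑.∑-map-swap (λ ℓ t → ∑[ n ≤ N ] summand ℓ n t) U I ⟩
    ∑[ t ∈ I ] ∑[ ℓ ≤ N ] ∑[ n ≤ N ] summand ℓ n t
      ≡⟨ ℚ∑.∑-map-congᴬ (All.map (∑-summand≡termA _) (incTuples-isIncTuple a N)) ⟩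
    ∑[ t ∈ I ] toℚ (termA k r t N)
      ≡⟨ sym (Toℚ.∑-map-homo (λ t → termA k r t N) I) ⟩
    toℚ (coeffA a k r N) ∎)
    where
      open ≡-Reasoning
      U = upTo (suc N)
      I = incTuples a N
      rhsSummand = λ ℓ n → if cond ℓ n then evalP (polyA a ℓ n) (toℚ k) else 0ℚ

module _ (a : ℕ) (k : ℤ) (r s N : ℕ) .{{_ : ℕ.NonZero r}} .{{_ : ℕ.NonZero s}} where
  private
    E : List ℕ → ℕ → ℚ
    E t ℓ = evalP (prodInvPowP t ℓ) (toℚ k)

    cond : ℕ → ℕ → ℕ → Bool
    cond ℓ n m = ⌊ a ℕ.* suc a ℕ.≤? 2 ℕ.* n ⌋ ∧ ⌊ n ℕ.* n ℕ.≤? a ℕ.* m ⌋ ∧ ⌊ m ℕ.≤? n ℕ.* n ⌋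
                 ∧ ⌊ m ℕ.* r ℕ.+ n ℕ.* s ℕ.+ ℓ ℕ.≟ N ⌋

    summand : ℕ → ℕ → ℕ → List ℕ → ℚ
    summand ℓ n m t =
      if cond ℓ n m then (if ⌊ sum t ℕ.≟ n ⌋ ∧ ⌊ sumSq t ℕ.≟ m ⌋ then E t ℓ else 0ℚ) else 0ℚ

    cond-false : ∀ ℓ n m → N < m ℕ.* r ℕ.+ n ℕ.* s → cond ℓ n m ≡ false
    cond-false ℓ n m N<W =
      ∧-false ⌊ a ℕ.* suc a ℕ.≤? 2 ℕ.* n ⌋ (∧-false ⌊ n ℕ.* n ℕ.≤? a ℕ.* m ⌋ (∧-false ⌊ m ℕ.≤? n ℕ.* n ⌋
        (⌊⌋-no (m ℕ.* r ℕ.+ n ℕ.* s ℕ.+ ℓ ℕ.≟ N)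
               (λ e → ℕ.<⇒≱ N<W (subst (m ℕ.* r ℕ.+ n ℕ.* s ≤_) e (ℕ.m≤m+n _ ℓ))))))

    cond-holds : ∀ t → IsIncTuple a N t → ∀ ℓ →
      cond ℓ (sum t) (sumSq t) ≡ ⌊ sumSq t ℕ.* r ℕ.+ sum t ℕ.* s ℕ.+ ℓ ℕ.≟ N ⌋
    cond-holds t p ℓ
      rewrite ⌊⌋-yes (a ℕ.* suc a ℕ.≤? 2 ℕ.* sum t) (triangular p)
            | ⌊⌋-yes (sum t ℕ.* sum t ℕ.≤? a ℕ.* sumSq t)
                     (subst (λ a → sum t ℕ.* sum t ≤ a ℕ.* sumSq t) (length≡a p) (sum²≤length*sumSq t))
            | ⌊⌋-yes (sumSq t ℕ.≤? sum t ℕ.* sum t) (sumSq≤sum² t) = refl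

    ∑-summand≡termB : ∀ t → IsIncTuple a N t →
      ∑[ ℓ ≤ N ] ∑[ n ≤ N ] ∑[ m ≤ N ] summand ℓ n m t ≡ toℚ (termB k r s t N)
    ∑-summand≡termB t p = begin
      ∑[ ℓ ≤ N ] ∑[ n ≤ N ] ∑[ m ≤ N ] summand ℓ n m t
        ≡⟨ ℚ∑.∑-map-cong U (λ ℓ → trans (ℚ∑.∑-map-cong U (collapse-m ℓ)) (collapse-n ℓ)) ⟩
      ∑[ ℓ ≤ N ] (if cond ℓ (sum t) (sumSq t) then E t ℓ else 0ℚ)
        ≡⟨ ℚ∑.∑-map-cong U (λ ℓ → cong (if_then E t ℓ else 0ℚ) (cond-holds t p ℓ)) ⟩
      ∑[ ℓ ≤ N ] (if ⌊ sumSq t ℕ.* r ℕ.+ sum t ℕ.* s ℕ.+ ℓ ℕ.≟ N ⌋ then E t ℓ else 0ℚ)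
        ≡⟨ cong (λ W → ∑[ ℓ ≤ N ] (if ⌊ W ℕ.+ ℓ ℕ.≟ N ⌋ then E t ℓ else 0ℚ)) (sym (sum-map-r*n²+s*n r s t)) ⟩
      ∑[ ℓ ≤ N ] (if ⌊ sum (map w t) ℕ.+ ℓ ℕ.≟ N ⌋ then E t ℓ else 0ℚ)
        ≡⟨ evalP-prodInvPowP-shift w k t (positive p) N ⟩
      toℚ (termB k r s t N) ∎
      where
        open ≡-Reasoning
        U = upTo (suc N)
        w = λ n → r ℕ.* (n ℕ.* n) ℕ.+ s ℕ.* n

        collapse-m : ∀ ℓ n →
          ∑[ m ≤ N ] summand ℓ n m t ≡ (if ⌊ sum t ℕ.≟ n ⌋ then (if cond ℓ n (sumSq t) then E t ℓ else 0ℚ) else 0ℚ)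
        collapse-m ℓ n = trans
          (ℚ∑.∑-map-cong U (λ m → ℚ∑.if-∧-swap ⌊ sum t ℕ.≟ n ⌋ ⌊ sumSq t ℕ.≟ m ⌋ (cond ℓ n m) (E t ℓ)))
          (ℚ∑.∑-upTo-collapse N (sumSq t) (λ m → if ⌊ sum t ℕ.≟ n ⌋ then (if cond ℓ n m then E t ℓ else 0ℚ) else 0ℚ)
            (λ N<Σt² → trans (cong (λ b → if ⌊ sum t ℕ.≟ n ⌋ then (if b then E t ℓ else 0ℚ) else 0ℚ)
                                   (cond-false ℓ n (sumSq t) (ℕ.<-≤-trans N<Σt² (ℕ.≤-trans (ℕ.m≤m*n _ r) (ℕ.m≤m+n _ _)))))
                             (ℚ∑.if-0# _)))

        collapse-n : ∀ ℓ → ∑[ n ≤ N ] (if ⌊ sum t ℕ.≟ n ⌋ then (if cond ℓ n (sumSq t) then E t ℓ else 0ℚ) else 0ℚ)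
                           ≡ (if cond ℓ (sum t) (sumSq t) then E t ℓ else 0ℚ)
        collapse-n ℓ = ℚ∑.∑-upTo-collapse N (sum t) (λ n → if cond ℓ n (sumSq t) then E t ℓ else 0ℚ)
          (λ N<Σt → cong (if_then E t ℓ else 0ℚ)
                         (cond-false ℓ (sum t) (sumSq t) (ℕ.<-≤-trans N<Σt (ℕ.≤-trans (ℕ.m≤m*n _ s) (ℕ.m≤n+m _ _)))))

  coeffB≡rhsB : toℚ (coeffB a k r s N) ≡ rhsB a (polyB a) k r s N
  coeffB≡rhsB = sym (begin
    rhsB a (polyB a) k r s N
      ≡⟨ ℚ∑.∑-concatMap (λ ℓ → concatMap (λ n → map (rhsSummand ℓ n) U) U) U ⟩
    ∑[ ℓ ≤ N ] ℚ∑.∑ (concatMap (λ n → map (rhsSummand ℓ n) U) U)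
      ≡⟨ ℚ∑.∑-map-cong U (λ ℓ → ℚ∑.∑-concatMap (λ n → map (rhsSummand ℓ n) U) U) ⟩
    ∑[ ℓ ≤ N ] ∑[ n ≤ N ] ∑[ m ≤ N ] rhsSummand ℓ n m
      ≡⟨ ℚ∑.∑-map-cong U (λ ℓ → ℚ∑.∑-upTo-cong (suc N) (λ n n≤N → ℚ∑.∑-map-cong U (λ m →
           evalP-tuplePoly a N (λ t → ⌊ sum t ℕ.≟ n ⌋ ∧ ⌊ sumSq t ℕ.≟ m ⌋) ℓ (toℚ k) (cond ℓ n m)
             (ℕ.≤-pred n≤N)
             (λ t n<Σt → cong (_∧ ⌊ sumSq t ℕ.≟ m ⌋) (⌊⌋-no (sum t ℕ.≟ n) (ℕ.<⇒≢ n<Σt ∘ sym)))))) ⟩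
    ∑[ ℓ ≤ N ] ∑[ n ≤ N ] ∑[ m ≤ N ] ∑[ t ∈ I ] summand ℓ n m t
      ≡⟨ ℚ∑.∑-map-cong U (λ ℓ → ℚ∑.∑-map-cong U (λ n → ℚ∑.∑-map-swap (summand ℓ n) U I)) ⟩
    ∑[ ℓ ≤ N ] ∑[ n ≤ N ] ∑[ t ∈ I ] ∑[ m ≤ N ] summand ℓ n m t
      ≡⟨ ℚ∑.∑-map-cong U (λ ℓ → ℚ∑.∑-map-swap (λ n t → ∑[ m ≤ N ] summand ℓ n m t) U I) ⟩
    ∑[ ℓ ≤ N ] ∑[ t ∈ I ] ∑[ n ≤ N ] ∑[ m ≤ N ] summand ℓ n m t
      ≡⟨ ℚ∑.∑-map-swap (λ ℓ t → ∑[ n ≤ N ] ∑[ m ≤ N ] summand ℓ n m t) U I ⟩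
    ∑[ t ∈ I ] ∑[ ℓ ≤ N ] ∑[ n ≤ N ] ∑[ m ≤ N ] summand ℓ n m t
      ≡⟨ ℚ∑.∑-map-congᴬ (All.map (∑-summand≡termB _) (incTuples-isIncTuple a N)) ⟩
    ∑[ t ∈ I ] toℚ (termB k r s t N)
      ≡⟨ sym (Toℚ.∑-map-homo (λ t → termB k r s t N) I) ⟩
    toℚ (coeffB a k r s N) ∎)
    where
      open ≡-Reasoning
      U = upTo (suc N)
      I = incTuples a N
      rhsSummand = λ ℓ n m → if cond ℓ n m then evalP (polyB a ℓ m n) (toℚ k) else 0ℚ

theorem1p3 : (a : ℕ) → 1 ≤ a →
    Σ (ℕ → ℕ → Poly) (λ P → Σ (ℕ → ℕ → ℕ → Poly) (λ Q →
      ((ℓ n : ℕ) → length (P ℓ n) ≤ suc ℓ)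
      × ((ℓ m n : ℕ) → length (Q ℓ m n) ≤ suc ℓ)
      × ((k : ℤ) (r s : ℕ) → 1 ≤ r → 1 ≤ s → (N : ℕ) →
           (toℚ (coeffA a k r N) ≡ rhsA a P k r N)
           × (toℚ (coeffB a k r s N) ≡ rhsB a Q k r s N))))
theorem1p3 a _ =
    polyA a
  , polyB a
  , (λ ℓ n → length-tuplePoly a n _ ℓ)
  , (λ ℓ m n → length-tuplePoly a n _ ℓ)
  , λ { k (suc r) (suc s) _ _ N → coeffA≡rhsA a k (suc r) N , coeffB≡rhsB a k (suc r) (suc s) N }
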